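{- Let $\tau$ be a vocabulary. For every $\mathcal{D}({\sf M})[\tau]$-formula $\phi$ there is a $\tau\cup \{S\}$-sentence $\psi$ of ${\rm SO}({\sf Most}_{\rm fun})$ such that for all models ${\mathfrak A}$ and teams $X$ with ${\rm dom}(X)={\rm Fr}(\phi)$ it holds that \[{\mathfrak A}\models_X \phi \iff ({\mathfrak A},\mathrm{rel}(X))\models\psi . \]
   Context: All structures are finite. Dependence logic $\mathcal{D}$ extends first-order logic (formulas in negation normal form) with dependence atoms $=\!\!(t_1,\ldots,t_n)$, evaluated over teams: a team $X$ of $A$ with domain $\{x_1,\ldots,x_k\}$ is a set of assignments $s\colon\{x_1,\ldots,x_k\}\to A$, and $\mathrm{rel}(X)=\{(s(x_1),\ldots,s(x_k)) : s\in X\}$. In team semantics: first-order literals hold in $X$ iff they hold under every $s\in X$; ${\mathfrak A}\models_X =\!\!(t_1,\ldots,t_n)$ iff any two assignments of $X$ agreeing on $t_1,\ldots,t_{n-1}$ agree on $t_n$; negated dependence atoms hold only in the empty team; $\wedge$ is evaluated on the same team; ${\mathfrak A}\models_X\psi\vee\phi$ iff $X=Y\cup Z$ with ${\mathfrak A}\models_Y\psi$ and ${\mathfrak A}\models_Z\phi$; ${\mathfrak A}\models_X\exists x\psi$ iff ${\mathfrak A}\models_{X(F/x)}\psi$ for some $F\colon X\to A$, where $X(F/x)=\{s(F(s)/x): s\in X\}$; ${\mathfrak A}\models_X\forall x\psi$ iff ${\mathfrak A}\models_{X(A/x)}\psi$, where $X(A/x)=\{s(a/x): s\in X, a\in A\}$.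 $\mathcal{D}({\sf M})$ adds the majority quantifier with semantics: ${\mathfrak A}\models_X {\sf M} x\phi$ iff for at least $|A|^{|X|}/2$ many functions $F\colon X\to A$ we have ${\mathfrak A}\models_{X(F/x)}\phi$. The functional majority quantifier ${\sf Most}^k_{\rm fun}$ binds a $k$-ary function symbol $g$: for $|A|=n$, ${\mathfrak A}\models {\sf Most}^k_{\rm fun}\, g\,\phi(g)$ iff $|\{f\colon A^k\to A : {\mathfrak A}\models\phi(f)\}|\ge n^{n^k}/2$. ${\rm SO}({\sf Most}_{\rm fun})$ is second-order logic extended with ${\sf Most}^k_{\rm fun}$ for all $k\ge1$. $S$ is a new relation symbol of arity $|{\rm Fr}(\phi)|$, interpreted by $\mathrm{rel}(X)$. -}

module Defs where

open import Level using (Level; 0ℓ) renaming (suc to lsuc)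
open import Data.Nat using (ℕ; zero; suc; _+_; _*_; _^_; _≤_)
open import Data.Bool using (Bool; true; false; _∧_; _∨_; not; if_then_else_)
open import Data.Fin using (Fin; zero; suc)
open import Data.Fin.Properties using () renaming (_≟_ to _≟Fin_)
open import Data.Maybe using (Maybe; just; nothing; is-just)
import Data.Maybe.Properties as MaybeP
open import Data.Vec using (Vec; []; _∷_; lookup; map; updateAt; replicate; zipWith)
import Data.Vec.Properties as VecP
open import Data.List using (List; []; _∷_; _++_; concatMap; length; filter; allFin)
open import Data.Bool.ListAction using (any)
import Data.List as L
open import Data.Product using (Σ; _×_; _,_)
open import Data.Sum using (_⊎_)
open import Relation.Nullary using (¬_)
open import Relation.Nullary.Decidable using (⌊_⌋)
open import Relation.Binary.PropositionalEquality using (_≡_; _≢_)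

-- Vocabularies (finite; relation symbols and function symbols,
-- constants being 0-ary function symbols)

record Vocab : Set where
  field
    nRel  : ℕ
    rAr   : Fin nRel → ℕ
    nFun  : ℕ
    fAr   : Fin nFun → ℕ
open Vocab public

-- τ ∪ {S}, S a fresh relation symbol of arity k (S is relation symbol zero)
_+S_ : Vocab → ℕ → Vocab
τ +S k = record
  { nRel = suc (nRel τ)
  ; rAr  = λ { zero → k ; (suc r) → rAr τ r }
  ; nFun = nFun τ
  ; fAr  = fAr τ }

record Structure (τ : Vocab) : Set where
  field
    size  : ℕ
    relI  : (r : Fin (nRel τ)) → Vec (Fin (suc size)) (rAr τ r) → Bool
    funI  : (f : Fin (nFun τ)) → Vec (Fin (suc size)) (fAr τ f) → Fin (suc size)
open Structure public

expand : ∀ {τ k} (𝔄 : Structure τ) → (Vec (Fin (suc (size 𝔄))) k → Bool) → Structure (τ +S k)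
expand 𝔄 R = record
  { size = size 𝔄
  ; relI = λ { zero → R ; (suc r) → relI 𝔄 r }
  ; funI = funI 𝔄 }

-- Dependence logic with the majority quantifier, D(M)[τ].
-- Formulas are in negation normal form; variables are named, drawn
-- from the finite set Fin V (V arbitrary).

data Term (τ : Vocab) (V : ℕ) : Set where
  var : Fin V → Term τ V
  app : (f : Fin (nFun τ)) → Vec (Term τ V) (fAr τ f) → Term τ V

data DForm (τ : Vocab) (V : ℕ) : Set where
  eq     : Term τ V → Term τ V → DForm τ V
  neq    : Term τ V → Term τ V → DForm τ V
  rel    : (r : Fin (nRel τ)) → Vec (Term τ V) (rAr τ r) → DForm τ V
  nrel   : (r : Fin (nRel τ)) → Vec (Term τ V) (rAr τ r) → DForm τ V
  -- dep ts t  is  =(t₁,…,tₘ,t)   ;  ndep ts t  is  ¬=(t₁,…,tₘ,t)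
  dep    : ∀ {m} → Vec (Term τ V) m → Term τ V → DForm τ V
  ndep   : ∀ {m} → Vec (Term τ V) m → Term τ V → DForm τ V
  and    : DForm τ V → DForm τ V → DForm τ V
  or     : DForm τ V → DForm τ V → DForm τ V
  ex     : Fin V → DForm τ V → DForm τ V
  all    : Fin V → DForm τ V → DForm τ V
  maj    : Fin V → DForm τ V → DForm τ V

VarSet : ℕ → Set
VarSet V = Vec Bool V

∅ : ∀ {V} → VarSet V
∅ = replicate _ false

_∪_ : ∀ {V} → VarSet V → VarSet V → VarSet V
_∪_ = zipWith _∨_

single : ∀ {V} → Fin V → VarSet V
single x = updateAt ∅ x (λ _ → true)

remove : ∀ {V} → Fin V → VarSet V → VarSet V
remove x D = updateAt D x (λ _ → false)

card : ∀ {V} → VarSet V → ℕ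
card [] = zero
card (true ∷ D) = suc (card D)
card (false ∷ D) = card D

elems : ∀ {V} → (D : VarSet V) → Vec (Fin V) (card D)
elems [] = []
elems (true ∷ D) = zero ∷ map suc (elems D)
elems (false ∷ D) = map suc (elems D)

mutual
  tvars : ∀ {τ V} → Term τ V → VarSet V
  tvars (var x) = single x
  tvars (app f ts) = tsvars ts

  tsvars : ∀ {τ V m} → Vec (Term τ V) m → VarSet V
  tsvars [] = ∅
  tsvars (t ∷ ts) = tvars t ∪ tsvars ts

Fr : ∀ {τ V} → DForm τ V → VarSet V
Fr (eq t u) = tvars t ∪ tvars u
Fr (neq t u) = tvars t ∪ tvars u
Fr (rel r ts) = tsvars ts
Fr (nrel r ts) = tsvars ts
Fr (dep ts t) = tsvars ts ∪ tvars t
Fr (ndep ts t) = tsvars ts ∪ tvars t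
Fr (and φ ψ) = Fr φ ∪ Fr ψ
Fr (or φ ψ) = Fr φ ∪ Fr ψ
Fr (ex x φ) = remove x (Fr φ)
Fr (all x φ) = remove x (Fr φ)
Fr (maj x φ) = remove x (Fr φ)

-- An assignment with domain D ⊆ Fin V into A = Fin n is a vector
-- s : Vec (Maybe (Fin n)) V with  s(x) = just a  for x ∈ D and
-- s(x) = nothing for x ∉ D.

Asg : ℕ → ℕ → Set
Asg n V = Vec (Maybe (Fin n)) V

Team : ℕ → ℕ → Set
Team n V = Asg n V → Bool

HasDom : ∀ {n V} → Team n V → VarSet V → Set
HasDom X D = ∀ s → X s ≡ true → map is-just s ≡ D

allMaybe : ∀ n → List (Maybe (Fin n))
allMaybe n = nothing ∷ L.map just (allFin n)

allAsg : ∀ n V → List (Asg n V)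
allAsg n zero = [] ∷ []
allAsg n (suc V) = concatMap (λ m → L.map (m ∷_) (allAsg n V)) (allMaybe n)

_==A_ : ∀ {n V} → Asg n V → Asg n V → Bool
s ==A s' = ⌊ VecP.≡-dec (MaybeP.≡-dec _≟Fin_) s s' ⌋

tsize : ∀ {n V} → Team n V → ℕ
tsize {n} {V} X = length (filter (λ s → X s Data.Bool.≟ true) (allAsg n V))

_[_↦_] : ∀ {n V} → Asg n V → Fin V → Fin n → Asg n V
s [ x ↦ a ] = updateAt s x (λ _ → just a)

supp : ∀ {n V} → Team n V → (Asg n V → Fin n) → Fin V → Team n V
supp {n} {V} X F x s' = any (λ s → X s ∧ (s' ==A (s [ x ↦ F s ]))) (allAsg n V)

dupl : ∀ {n V} → Team n V → Fin V → Team n V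
dupl {n} {V} X x s' =
  any (λ s → X s ∧ any (λ a → s' ==A (s [ x ↦ a ])) (allFin n)) (allAsg n V)

-- rel(X) for dom(X) = D: tuples (s(x₁),…,s(x_k)), x₁ < … < x_k the elements of D
relT : ∀ {n V} → (D : VarSet V) → Team n V → Vec (Fin n) (card D) → Bool
relT {n} {V} D X t =
  any (λ s → X s ∧ ⌊ VecP.≡-dec (MaybeP.≡-dec _≟Fin_) (map (lookup s) (elems D)) (map just t) ⌋)
      (allAsg n V)

-- "at least N distinct functions F : X → A satisfy P"; functions are
-- represented by total functions on assignments, two of them being the
-- same function X → A iff they agree on every s ∈ X.

AtLeastOn : ∀ {n V} → Team n V → ℕ → ((Asg n V → Fin n) → Set) → Set
AtLeastOn {n} {V} X N P =
  Σ (Fin N → (Asg n V → Fin n)) λ G →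
    (∀ i j → i ≢ j → Σ (Asg n V) λ s → X s ≡ true × G i s ≢ G j s)
    × (∀ i → P (G i))

module _ {τ : Vocab} (𝔄 : Structure τ) where
  private
    A : Set
    A = Fin (suc (size 𝔄))

  mutual
    evalT : ∀ {V} → Asg (suc (size 𝔄)) V → Term τ V → Maybe A
    evalT s (var x) = lookup s x
    evalT s (app f ts) = Data.Maybe.map (funI 𝔄 f) (evalTs s ts)

    evalTs : ∀ {V m} → Asg (suc (size 𝔄)) V → Vec (Term τ V) m → Maybe (Vec A m)
    evalTs s [] = just []
    evalTs s (t ∷ ts) with evalT s t | evalTs s ts
    ... | just a | just as = just (a ∷ as)
    ... | _      | _       = nothing

  -- truth of a first-order literal under a single assignment
  -- (terms with a variable outside dom(s) make the literal false;
  --  this never happens when dom(X) ⊇ Fr(φ))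
  holdsEq : ∀ {V} → Asg (suc (size 𝔄)) V → Term τ V → Term τ V → Bool → Set
  holdsEq s t u b with evalT s t | evalT s u
  ... | just a | just c = ⌊ a ≟Fin c ⌋ ≡ b
  ... | _      | _      = Data.Empty.⊥
    where import Data.Empty

  holdsRel : ∀ {V} → Asg (suc (size 𝔄)) V → (r : Fin (nRel τ)) → Vec (Term τ V) (rAr τ r) → Bool → Set
  holdsRel s r ts b with evalTs s ts
  ... | just as = relI 𝔄 r as ≡ b
  ... | nothing = Data.Empty.⊥
    where import Data.Empty

  sat : ∀ {V} → DForm τ V → Team (suc (size 𝔄)) V → Set
  sat (eq t u) X = ∀ s → X s ≡ true → holdsEq s t u true
  sat (neq t u) X = ∀ s → X s ≡ true → holdsEq s t u false
  sat (rel r ts) X = ∀ s → X s ≡ true → holdsRel s r ts true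
  sat (nrel r ts) X = ∀ s → X s ≡ true → holdsRel s r ts false
  sat (dep ts t) X = ∀ s s' → X s ≡ true → X s' ≡ true →
                     evalTs s ts ≡ evalTs s' ts → evalT s t ≡ evalT s' t
  sat (ndep ts t) X = ∀ s → X s ≡ false
  sat (and φ ψ) X = sat φ X × sat ψ X
  sat (or φ ψ) X = Σ (Team (suc (size 𝔄)) _) λ Y → Σ (Team (suc (size 𝔄)) _) λ Z →
                     (∀ s → X s ≡ (Y s ∨ Z s)) × sat φ Y × sat ψ Z
  sat (ex x φ) X = Σ (Asg (suc (size 𝔄)) _ → A) λ F → sat φ (supp X F x)
  sat (all x φ) X = sat φ (dupl X x)
  sat (maj x φ) X = Σ ℕ λ N → (suc (size 𝔄) ^ tsize X ≤ 2 * N) ×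
                     AtLeastOn X N (λ F → sat φ (supp X F x))

-- Variables are de Bruijn indices; a context lists the number of
-- first-order variables and the arities of relation and function variables.

record Ctx : Set where
  constructor ctx
  field
    nFO : ℕ
    rvs : List ℕ
    fvs : List ℕ
open Ctx public

addFO : Ctx → Ctx
addFO (ctx a r f) = ctx (suc a) r f

addR : ℕ → Ctx → Ctx
addR k (ctx a r f) = ctx a (k ∷ r) f

addF : ℕ → Ctx → Ctx
addF k (ctx a r f) = ctx a r (k ∷ f)

data STerm (σ : Vocab) (Γ : Ctx) : Set where
  svar : Fin (nFO Γ) → STerm σ Γ
  sapp : (f : Fin (nFun σ)) → Vec (STerm σ Γ) (fAr σ f) → STerm σ Γ
  fvar : (g : Fin (length (fvs Γ))) → Vec (STerm σ Γ) (L.lookup (fvs Γ) g) → STerm σ Γ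

data SForm (σ : Vocab) : Ctx → Set where
  seq   : ∀ {Γ} → STerm σ Γ → STerm σ Γ → SForm σ Γ
  srel  : ∀ {Γ} (r : Fin (nRel σ)) → Vec (STerm σ Γ) (rAr σ r) → SForm σ Γ
  rvar  : ∀ {Γ} (R : Fin (length (rvs Γ))) → Vec (STerm σ Γ) (L.lookup (rvs Γ) R) → SForm σ Γ
  sneg  : ∀ {Γ} → SForm σ Γ → SForm σ Γ
  sand  : ∀ {Γ} → SForm σ Γ → SForm σ Γ → SForm σ Γ
  sor   : ∀ {Γ} → SForm σ Γ → SForm σ Γ → SForm σ Γ
  sex   : ∀ {Γ} → SForm σ (addFO Γ) → SForm σ Γ
  sall  : ∀ {Γ} → SForm σ (addFO Γ) → SForm σ Γ
  sexR  : ∀ {Γ} k → SForm σ (addR k Γ) → SForm σ Γ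
  sallR : ∀ {Γ} k → SForm σ (addR k Γ) → SForm σ Γ
  sexF  : ∀ {Γ} k → SForm σ (addF k Γ) → SForm σ Γ
  sallF : ∀ {Γ} k → SForm σ (addF k Γ) → SForm σ Γ
  most  : ∀ {Γ} k → SForm σ (addF k Γ) → SForm σ Γ

Sentence : Vocab → Set
Sentence σ = SForm σ (ctx 0 [] [])

record Env (n : ℕ) (Γ : Ctx) : Set where
  constructor env
  field
    foE : Vec (Fin n) (nFO Γ)
    rE  : (R : Fin (length (rvs Γ))) → Vec (Fin n) (L.lookup (rvs Γ) R) → Bool
    fE  : (g : Fin (length (fvs Γ))) → Vec (Fin n) (L.lookup (fvs Γ) g) → Fin n
open Env public

extFO : ∀ {n Γ} → Env n Γ → Fin n → Env n (addFO Γ)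
extFO (env a r f) x = env (x ∷ a) r f

extR : ∀ {n Γ k} → Env n Γ → (Vec (Fin n) k → Bool) → Env n (addR k Γ)
extR (env a r f) R = env a (λ { zero → R ; (suc i) → r i }) f

extF : ∀ {n Γ k} → Env n Γ → (Vec (Fin n) k → Fin n) → Env n (addF k Γ)
extF (env a r f) g = env a r (λ { zero → g ; (suc i) → f i })

emptyEnv : ∀ {n} → Env n (ctx 0 [] [])
emptyEnv = env [] (λ ()) (λ ())

module _ {σ : Vocab} (𝔅 : Structure σ) where
  private
    n : ℕ
    n = suc (size 𝔅)
    B : Set
    B = Fin n

  mutual
    sevalT : ∀ {Γ} → Env n Γ → STerm σ Γ → B
    sevalT ρ (svar x) = lookup (foE ρ) x
    sevalT ρ (sapp f ts) = funI 𝔅 f (sevalTs ρ ts)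
    sevalT ρ (fvar g ts) = fE ρ g (sevalTs ρ ts)

    sevalTs : ∀ {Γ m} → Env n Γ → Vec (STerm σ Γ) m → Vec B m
    sevalTs ρ [] = []
    sevalTs ρ (t ∷ ts) = sevalT ρ t ∷ sevalTs ρ ts

  AtLeastFun : (k N : ℕ) → ((Vec B k → B) → Set) → Set
  AtLeastFun k N P =
    Σ (Fin N → (Vec B k → B)) λ G →
      (∀ i j → i ≢ j → Σ (Vec B k) λ v → G i v ≢ G j v)
      × (∀ i → P (G i))

  ssat : ∀ {Γ} → SForm σ Γ → Env n Γ → Set
  ssat (seq t u) ρ = sevalT ρ t ≡ sevalT ρ u
  ssat (srel r ts) ρ = relI 𝔅 r (sevalTs ρ ts) ≡ true
  ssat (rvar R ts) ρ = rE ρ R (sevalTs ρ ts) ≡ true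
  ssat (sneg φ) ρ = ¬ ssat φ ρ
  ssat (sand φ ψ) ρ = ssat φ ρ × ssat ψ ρ
  ssat (sor φ ψ) ρ = ssat φ ρ ⊎ ssat ψ ρ
  ssat (sex φ) ρ = Σ B λ a → ssat φ (extFO ρ a)
  ssat (sall φ) ρ = ∀ a → ssat φ (extFO ρ a)
  ssat (sexR k φ) ρ = Σ (Vec B k → Bool) λ R → ssat φ (extR ρ R)
  ssat (sallR k φ) ρ = ∀ (R : Vec B k → Bool) → ssat φ (extR ρ R)
  ssat (sexF k φ) ρ = Σ (Vec B k → B) λ g → ssat φ (extF ρ g)
  ssat (sallF k φ) ρ = ∀ (g : Vec B k → B) → ssat φ (extF ρ g)
  ssat (most k φ) ρ = Σ ℕ λ N → (n ^ (n ^ k) ≤ 2 * N) ×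
                        AtLeastFun k N (λ g → ssat φ (extF ρ g))

  _⊨_ : Sentence σ → Set
  _⊨_ ψ = ssat ψ emptyEnv

module Submission where

-- A team X with domain D ⊆ {x₁,…,x_V} is coded by a V-ary relation: the tuples
-- of its assignments, padded with a fixed element a outside D (asgOf/tupleOf).
-- The translation tr D φ, with free variables a and a relation variable for the
-- team, follows team semantics clause by clause: flat formulas and dependence
-- atoms quantify over the tuples of the team, ∨ guesses two relations with union
-- the team, ∀x and ∃x define the relation of X(A/x) resp. X(F/x), where F is
-- a function variable g : Aⱽ → A, and Mx becomes Most^V g.  The one counting
-- argument is LocalCounting: the body of Mx only depends on g on the tuples of
-- the team, so "half of all F : X → A" is "half of all g : Aⱽ → A".  Finally
-- ψ = ∀a ∃R (R is the padded relation of S ∧ tr φ).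

open import Defs
open import Data.Nat using (ℕ; suc)
open import Data.Product using (Σ)
open import Function.Bundles using (_⇔_)

open import Data.Nat using (zero; _+_; _*_; _^_; _≤_)
import Data.Nat.Properties
open import Data.Nat.Properties
  using (≤-antisym; *-assoc; *-monoˡ-≤; *-monoʳ-≤; *-cancelʳ-≤; ^-distribˡ-+-*; m^n≢0; +-suc)
open import Data.Bool using (Bool; true; false; _∧_; _∨_; if_then_else_)
import Data.Bool as Bool
open import Data.Bool.Properties using (T-≡; ∧-distribˡ-∨; ∨-zeroʳ; ∨-identityʳ)
open import Data.Bool.ListAction using (any)
open import Data.Fin as Fin using (Fin; zero; suc; _↑ˡ_; _↑ʳ_; combine; remQuot; finToFun; funToFin)
import Data.Fin.Properties as FinP
open import Data.Maybe using (Maybe; just; nothing; is-just; fromMaybe)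
import Data.Maybe.Properties as MaybeP
open import Data.Vec as Vec using (Vec; []; _∷_; lookup; tabulate; _++_)
import Data.Vec.Properties as VecP
open import Data.List as L using (List; []; _∷_; length; allFin; filter; concatMap)
import Data.List.Properties as LP
open import Data.List.Relation.Unary.Any using (here; there; index)
open import Data.List.Relation.Unary.Any.Properties using (lookup-index; any⁺; any⁻)
import Data.List.Relation.Unary.All as All
import Data.List.Relation.Unary.All.Properties as AllP
import Data.List.Relation.Unary.AllPairs as AllPairs
import Data.List.Relation.Unary.AllPairs.Properties as AllPairsP
open import Data.List.Relation.Unary.Unique.Propositional using (Unique)
open import Data.List.Relation.Unary.Unique.Propositional.Properties
  using (Unique[x∷xs]⇒x∉xs; allFin⁺; filter⁺; map⁺; concat⁺)
import Data.List.Relation.Unary.Unique.DecPropositional.Properties as DedupP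
open import Data.List.Membership.Propositional using (_∈_; find; lose)
open import Data.List.Membership.Propositional.Properties
  using (∈-lookup; ∈-map⁺; ∈-map⁻; ∈-allFin; ∈-filter⁺; ∈-filter⁻; ∈-concatMap⁺; ∈-deduplicate⁺; ∈-deduplicate⁻)
open import Data.Product using (_×_; _,_; proj₁; proj₂)
open import Data.Product.Function.NonDependent.Propositional using (_×-⇔_)
open import Data.Sum as Sum using (_⊎_; inj₁; inj₂)
open import Data.Unit using (⊤)
open import Data.Empty using (⊥; ⊥-elim)
open import Relation.Nullary using (¬_; Dec; yes; no)
open import Relation.Nullary.Decidable using (⌊_⌋)
open import Relation.Binary.PropositionalEquality
open import Function.Base using (_∘_)
open import Function.Bundles using (mk⇔; Equivalence)
open import Function.Properties.Equivalence using () renaming (trans to ⇔-trans)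

lookup-injective : ∀ {A : Set} (xs : List A) → Unique xs → ∀ i j → L.lookup xs i ≡ L.lookup xs j → i ≡ j
lookup-injective (x ∷ xs) u zero zero e = refl
lookup-injective (x ∷ xs) u zero (suc j) e =
  ⊥-elim (Unique[x∷xs]⇒x∉xs u (subst (_∈ xs) (sym e) (∈-lookup j)))
lookup-injective (x ∷ xs) u (suc i) zero e =
  ⊥-elim (Unique[x∷xs]⇒x∉xs u (subst (_∈ xs) e (∈-lookup i)))
lookup-injective (x ∷ xs) (_ AllPairs.∷ u) (suc i) (suc j) e = cong suc (lookup-injective xs u i j e)

lookup-∈ : ∀ {A : Set} {x : A} {xs} (p : x ∈ xs) → L.lookup xs (index p) ≡ x
lookup-∈ p = sym (lookup-index p)

length-≤ : ∀ {A B : Set} (xs : List A) (ys : List B) → Unique xs → (f : A → B) →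
  (∀ x → x ∈ xs → f x ∈ ys) → (∀ x y → x ∈ xs → y ∈ xs → f x ≡ f y → x ≡ y) →
  length xs ≤ length ys
length-≤ xs ys u f into inj = FinP.injective⇒≤ {f = position} position-injective
  where
  position : Fin (length xs) → Fin (length ys)
  position i = index (into (L.lookup xs i) (∈-lookup i))
  position-injective : ∀ {i j} → position i ≡ position j → i ≡ j
  position-injective {i} {j} e = lookup-injective xs u i j (inj _ _ (∈-lookup i) (∈-lookup j) (begin
    f (L.lookup xs i)                ≡⟨ sym (lookup-∈ (into _ (∈-lookup i))) ⟩
    L.lookup ys (position i)         ≡⟨ cong (L.lookup ys) e ⟩
    L.lookup ys (position j)         ≡⟨ lookup-∈ (into _ (∈-lookup j)) ⟩
    f (L.lookup xs j)                ∎))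
    where open ≡-Reasoning

select : ∀ {A : Set} → (A → Bool) → Bool → List A → List A
select p b = filter (λ x → p x Bool.≟ b)

∈-select⁺ : ∀ {A : Set} (p : A → Bool) {b xs x} → x ∈ xs → p x ≡ b → x ∈ select p b xs
∈-select⁺ p {b} = ∈-filter⁺ (λ x → p x Bool.≟ b)

∈-select⁻ : ∀ {A : Set} (p : A → Bool) {b} xs {x} → x ∈ select p b xs → x ∈ xs × p x ≡ b
∈-select⁻ p {b} xs = ∈-filter⁻ (λ x → p x Bool.≟ b) {xs = xs}

select-unique : ∀ {A : Set} (p : A → Bool) b {xs} → Unique xs → Unique (select p b xs)
select-unique p b = filter⁺ (λ x → p x Bool.≟ b)

length-split : ∀ {A : Set} (p : A → Bool) xs → length (select p true xs) + length (select p false xs) ≡ length xs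
length-split p [] = refl
length-split p (x ∷ xs) with p x
... | true = cong suc (length-split p xs)
... | false = trans (+-suc _ _) (cong suc (length-split p xs))

vecs : ∀ {A : Set} → List A → (V : ℕ) → List (Vec A V)
vecs xs zero = [] ∷ []
vecs xs (suc V) = concatMap (λ a → L.map (a ∷_) (vecs xs V)) xs

vecs-complete : ∀ {A : Set} (xs : List A) → (∀ a → a ∈ xs) → ∀ {V} (v : Vec A V) → v ∈ vecs xs V
vecs-complete xs all∈ [] = here refl
vecs-complete xs all∈ (a ∷ v) = ∈-concatMap⁺ _ (lose (all∈ a) (∈-map⁺ (a ∷_) (vecs-complete xs all∈ v)))

vecs-unique : ∀ {A : Set} (xs : List A) → Unique xs → ∀ V → Unique (vecs xs V)
vecs-unique xs u zero = All.[] AllPairs.∷ AllPairs.[]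
vecs-unique xs u (suc V) =
  concat⁺ (AllP.map⁺ (All.universal (λ a → map⁺ ∷-injectiveʳ (vecs-unique xs u V)) xs))
          (AllPairsP.map⁺ (AllPairs.map disjoint u))
  where
  ∷-injectiveʳ : ∀ {a} {v w : Vec _ V} → _≡_ {A = Vec _ (suc V)} (a ∷ v) (a ∷ w) → v ≡ w
  ∷-injectiveʳ refl = refl
  disjoint : ∀ {a b} → a ≢ b → ∀ {v} → v ∈ L.map (a ∷_) (vecs xs V) × v ∈ L.map (b ∷_) (vecs xs V) → ⊥
  disjoint a≢b (p , q) with ∈-map⁻ _ p | ∈-map⁻ _ q
  ... | _ , _ , refl | _ , _ , refl = a≢b refl

length-concatMap : ∀ {A B : Set} (f : A → List B) k xs → (∀ a → length (f a) ≡ k) →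
  length (concatMap f xs) ≡ length xs * k
length-concatMap f k [] h = refl
length-concatMap f k (x ∷ xs) h =
  trans (LP.length-++ (f x)) (cong₂ _+_ (h x) (length-concatMap f k xs h))

vecs-length : ∀ {A : Set} (xs : List A) V → length (vecs xs V) ≡ length xs ^ V
vecs-length xs zero = refl
vecs-length xs (suc V) = length-concatMap _ (length xs ^ V) xs
  (λ a → trans (LP.length-map (a ∷_) (vecs xs V)) (vecs-length xs V))

funToFin-cong : ∀ {m n} (f g : Fin m → Fin n) → (∀ k → f k ≡ g k) → funToFin f ≡ funToFin g
funToFin-cong {zero} f g h = refl
funToFin-cong {suc m} f g h = cong₂ combine (h zero) (funToFin-cong (f ∘ suc) (g ∘ suc) (h ∘ suc))

differ-at : ∀ {m n} (f g : Fin m → Fin n) → funToFin f ≢ funToFin g → Σ (Fin m) λ k → f k ≢ g k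
differ-at {m} f g ne = FinP.¬∀⟶∃¬ m (λ k → f k ≡ g k) (λ k → f k FinP.≟ g k) (λ h → ne (funToFin-cong f g h))

same-code : ∀ {m n} (f g : Fin m → Fin n) → funToFin f ≡ funToFin g → ∀ k → f k ≡ g k
same-code f g e k = begin
  f k                       ≡⟨ sym (FinP.finToFun-funToFin f k) ⟩
  finToFun (funToFin f) k   ≡⟨ cong (λ c → finToFun c k) e ⟩
  finToFun (funToFin g) k   ≡⟨ FinP.finToFun-funToFin g k ⟩
  g k                       ∎
  where open ≡-Reasoning

-- The finite type T is listed without repetition by Lc followed by Ld, and P is a
-- property of functions T → Fin n that only depends on their values on Lc.  Then
-- "at least half of the n^c functions on Lc satisfy P" is equivalent to "at least
-- half of all n^(c+d) functions on T satisfy P": each function on Lc has exactly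
-- n^d extensions to T.
module LocalCounting (m : ℕ) (T : Set) (Lc Ld : List T) (uc : Unique Lc) (ud : Unique Ld)
  (disjoint : ∀ t → t ∈ Lc → t ∈ Ld → ⊥) (cover : ∀ t → t ∈ Lc ⊎ t ∈ Ld)
  (P : (T → Fin (suc m)) → Set)
  (local : ∀ f g → (∀ t → t ∈ Lc → f t ≡ g t) → P f → P g) where

  n c d : ℕ
  n = suc m
  c = length Lc
  d = length Ld

  DistinctOnLc : ℕ → Set
  DistinctOnLc N = Σ (Fin N → T → Fin n) λ G →
    (∀ i j → i ≢ j → Σ T λ t → t ∈ Lc × G i t ≢ G j t) × (∀ i → P (G i))

  Distinct : ℕ → Set
  Distinct M = Σ (Fin M → T → Fin n) λ G →
    (∀ i j → i ≢ j → Σ T λ t → G i t ≢ G j t) × (∀ i → P (G i))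

  -- A function on T is a pair of functions on the positions of Lc and of Ld.
  restrictC : (T → Fin n) → Fin c → Fin n
  restrictC g k = g (L.lookup Lc k)

  restrictD : (T → Fin n) → Fin d → Fin n
  restrictD g k = g (L.lookup Ld k)

  glue : (Fin c → Fin n) → (Fin d → Fin n) → T → Fin n
  glue f h t with cover t
  ... | inj₁ p = f (index p)
  ... | inj₂ q = h (index q)

  glue-restrictC : ∀ g h t → t ∈ Lc → glue (restrictC g) h t ≡ g t
  glue-restrictC g h t t∈ with cover t
  ... | inj₁ p = cong g (lookup-∈ p)
  ... | inj₂ q = ⊥-elim (disjoint t t∈ q)

  glue-Ld : ∀ f h k → glue f h (L.lookup Ld k) ≡ h k
  glue-Ld f h k with cover (L.lookup Ld k)
  ... | inj₁ p = ⊥-elim (disjoint _ p (∈-lookup k))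
  ... | inj₂ q = cong h (lookup-injective Ld ud _ _ (lookup-∈ q))

  determined-by-restrictions : ∀ g g' → (∀ k → restrictC g k ≡ restrictC g' k) →
    (∀ k → restrictD g k ≡ restrictD g' k) → ∀ t → g t ≡ g' t
  determined-by-restrictions g g' ec ed t with cover t
  ... | inj₁ p = subst (λ u → g u ≡ g' u) (lookup-∈ p) (ec (index p))
  ... | inj₂ q = subst (λ u → g u ≡ g' u) (lookup-∈ q) (ed (index q))

  -- Each of the N functions is extended in all n^d ways off Lc.
  extend : ∀ N → n ^ c ≤ 2 * N → DistinctOnLc N → Σ ℕ λ M → n ^ (c + d) ≤ 2 * M × Distinct M
  extend N half (G , dist , sat) = N * n ^ d , bound , G' , dist' , sat'
    where
    pair : Fin N × Fin (n ^ d) → T → Fin n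
    pair (i , j) = glue (restrictC (G i)) (finToFun j)
    G' : Fin (N * n ^ d) → T → Fin n
    G' x = pair (remQuot (n ^ d) x)
    bound : n ^ (c + d) ≤ 2 * (N * n ^ d)
    bound = begin
      n ^ (c + d)         ≡⟨ ^-distribˡ-+-* n c d ⟩
      n ^ c * n ^ d       ≤⟨ *-monoˡ-≤ (n ^ d) half ⟩
      2 * N * n ^ d       ≡⟨ *-assoc 2 N (n ^ d) ⟩
      2 * (N * n ^ d)     ∎
      where open Data.Nat.Properties.≤-Reasoning
    dist-pair : ∀ p q → p ≢ q → Σ T λ t → pair p t ≢ pair q t
    dist-pair (i , j) (i' , j') ne with i FinP.≟ i'
    ... | no i≢i' with dist i i' i≢i'
    ...   | t , t∈ , differ = t , λ e → differ (trans (sym (glue-restrictC (G i) _ t t∈))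
                                                   (trans e (glue-restrictC (G i') _ t t∈)))
    dist-pair (i , j) (i' , j') ne | yes refl with j FinP.≟ j'
    ... | yes refl = ⊥-elim (ne refl)
    ... | no j≢j' with differ-at (finToFun j) (finToFun j')
                         (λ e → j≢j' (trans (sym (FinP.funToFin-finToFin {d} {n} j)) (trans e (FinP.funToFin-finToFin {d} {n} j'))))
    ...   | k , differ = L.lookup Ld k , λ e → differ (trans (sym (glue-Ld _ (finToFun j) k))
                                                      (trans e (glue-Ld _ (finToFun j') k)))
    dist' : ∀ x y → x ≢ y → Σ T λ t → G' x t ≢ G' y t
    dist' x y ne = dist-pair (remQuot {N} (n ^ d) x) (remQuot {N} (n ^ d) y) λ e → ne (begin
      x                                                                     ≡⟨ sym (FinP.combine-remQuot {N} (n ^ d) x) ⟩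
      combine (proj₁ (remQuot {N} (n ^ d) x)) (proj₂ (remQuot {N} (n ^ d) x)) ≡⟨ cong (λ p → combine (proj₁ p) (proj₂ p)) e ⟩
      combine (proj₁ (remQuot {N} (n ^ d) y)) (proj₂ (remQuot {N} (n ^ d) y)) ≡⟨ FinP.combine-remQuot {N} (n ^ d) y ⟩
      y                                                                     ∎)
      where open ≡-Reasoning
    sat' : ∀ x → P (G' x)
    sat' x = local (G i) (G' x) (λ t t∈ → sym (glue-restrictC (G i) _ t t∈)) (sat i)
      where i = proj₁ (remQuot {N} (n ^ d) x)

  -- The distinct restrictions to Lc of M functions, times the n^d possible
  -- values off Lc, bound M from above.
  collapse : ∀ M → n ^ (c + d) ≤ 2 * M → Distinct M → Σ ℕ λ N → n ^ c ≤ 2 * N × DistinctOnLc N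
  collapse M half (G , dist , sat) = N , bound , G ∘ rep , dist' , sat ∘ rep
    where
    code : Fin M → Fin (n ^ c)
    code i = funToFin (restrictC (G i))
    codes : List (Fin (n ^ c))
    codes = L.deduplicate FinP._≟_ (L.map code (allFin M))
    N : ℕ
    N = length codes
    rep-spec : (ℓ : Fin N) → Σ (Fin M) λ i → L.lookup codes ℓ ≡ code i
    rep-spec ℓ with ∈-map⁻ code (∈-deduplicate⁻ FinP._≟_ (L.map code (allFin M)) (∈-lookup ℓ))
    ... | i , _ , e = i , e
    rep : Fin N → Fin M
    rep ℓ = proj₁ (rep-spec ℓ)
    dist' : ∀ ℓ ℓ' → ℓ ≢ ℓ' → Σ T λ t → t ∈ Lc × G (rep ℓ) t ≢ G (rep ℓ') t
    dist' ℓ ℓ' ne with differ-at (restrictC (G (rep ℓ))) (restrictC (G (rep ℓ')))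
      (λ e → ne (lookup-injective codes (DedupP.deduplicate-! FinP._≟_ _) ℓ ℓ'
                  (trans (proj₂ (rep-spec ℓ)) (trans e (sym (proj₂ (rep-spec ℓ')))))))
    ... | k , differ = L.lookup Lc k , ∈-lookup k , differ
    position : Fin M → Fin N
    position i = index (∈-deduplicate⁺ FinP._≟_ (∈-map⁺ code (∈-allFin i)))
    position-spec : ∀ i → L.lookup codes (position i) ≡ code i
    position-spec i = lookup-∈ (∈-deduplicate⁺ FinP._≟_ (∈-map⁺ code (∈-allFin i)))
    encode : Fin M → Fin (N * n ^ d)
    encode i = combine (position i) (funToFin (restrictD (G i)))
    encode-injective : ∀ {i j} → encode i ≡ encode j → i ≡ j
    encode-injective {i} {j} e with i FinP.≟ j
    ... | yes i≡j = i≡j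
    ... | no i≢j with dist i j i≢j
    ...   | t , differ = ⊥-elim (differ (determined-by-restrictions (G i) (G j)
                            (same-code _ _ same-c) (same-code _ _ (proj₂ parts)) t))
      where
      parts = FinP.combine-injective (position i) _ (position j) _ e
      same-c : code i ≡ code j
      same-c = trans (sym (position-spec i)) (trans (cong (L.lookup codes) (proj₁ parts)) (position-spec j))
    bound : n ^ c ≤ 2 * N
    bound = *-cancelʳ-≤ (n ^ c) (2 * N) (n ^ d) {{m^n≢0 n d}} (begin
      n ^ c * n ^ d       ≡⟨ sym (^-distribˡ-+-* n c d) ⟩
      n ^ (c + d)         ≤⟨ half ⟩
      2 * M               ≤⟨ *-monoʳ-≤ 2 (FinP.injective⇒≤ encode-injective) ⟩
      2 * (N * n ^ d)     ≡⟨ sym (*-assoc 2 N (n ^ d)) ⟩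
      2 * N * n ^ d       ∎)
      where open Data.Nat.Properties.≤-Reasoning

  majority-transfer : (Σ ℕ λ N → n ^ c ≤ 2 * N × DistinctOnLc N) ⇔ (Σ ℕ λ M → n ^ (c + d) ≤ 2 * M × Distinct M)
  majority-transfer = mk⇔ (λ (N , half , G) → extend N half G) (λ (M , half , G) → collapse M half G)

false≢true : false ≢ true
false≢true ()

bool-ext : ∀ {a b : Bool} → (a ≡ true → b ≡ true) → (b ≡ true → a ≡ true) → a ≡ b
bool-ext {true} {true} f g = refl
bool-ext {true} {false} f g = sym (f refl)
bool-ext {false} {true} f g = g refl
bool-ext {false} {false} f g = refl

∧-elim : ∀ {a b} → (a ∧ b) ≡ true → a ≡ true × b ≡ true
∧-elim {true} e = refl , e

∧-intro : ∀ {a b} → a ≡ true → b ≡ true → (a ∧ b) ≡ true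
∧-intro refl refl = refl

∨-introˡ : ∀ {a b} → a ≡ true → (a ∨ b) ≡ true
∨-introˡ refl = refl

∨-introʳ : ∀ a {b} → b ≡ true → (a ∨ b) ≡ true
∨-introʳ true e = refl
∨-introʳ false e = e

∨-elim : ∀ {a b} → (a ∨ b) ≡ true → (a ≡ true) ⊎ (b ≡ true)
∨-elim {true} e = inj₁ refl
∨-elim {false} e = inj₂ e

⌊⌋⇒ : ∀ {P : Set} (d : Dec P) → ⌊ d ⌋ ≡ true → P
⌊⌋⇒ (yes p) e = p

⇒⌊⌋ : ∀ {P : Set} (d : Dec P) → P → ⌊ d ⌋ ≡ true
⇒⌊⌋ (yes p) _ = refl
⇒⌊⌋ (no ¬p) p = ⊥-elim (¬p p)

vec-ext : ∀ {A : Set} {V} (u v : Vec A V) → (∀ i → lookup u i ≡ lookup v i) → u ≡ v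
vec-ext u v h = trans (sym (VecP.tabulate∘lookup u)) (trans (VecP.tabulate-cong h) (VecP.tabulate∘lookup v))

Sub : ∀ {V} → VarSet V → VarSet V → Set
Sub D E = ∀ i → lookup D i ≡ true → lookup E i ≡ true

lookup-∪ : ∀ {V} (D E : VarSet V) i → lookup (D ∪ E) i ≡ (lookup D i ∨ lookup E i)
lookup-∪ D E i = VecP.lookup-zipWith _∨_ i D E

Sub-∪ˡ : ∀ {V} (D E F : VarSet V) → Sub (D ∪ E) F → Sub D F
Sub-∪ˡ D E F h i e = h i (trans (lookup-∪ D E i) (∨-introˡ e))

Sub-∪ʳ : ∀ {V} (D E F : VarSet V) → Sub (D ∪ E) F → Sub E F
Sub-∪ʳ D E F h i e = h i (trans (lookup-∪ D E i) (∨-introʳ (lookup D i) e))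

∪single-≡ : ∀ {V} (D : VarSet V) x → lookup (D ∪ single x) x ≡ true
∪single-≡ D x = trans (lookup-∪ D (single x) x)
  (trans (cong (lookup D x ∨_) (VecP.lookup∘updateAt x ∅)) (∨-zeroʳ _))

∪single-≢ : ∀ {V} (D : VarSet V) x i → i ≢ x → lookup (D ∪ single x) i ≡ lookup D i
∪single-≢ D x i ne = trans (lookup-∪ D (single x) i)
  (trans (cong (lookup D i ∨_) (trans (VecP.lookup∘updateAt′ i x ne ∅) (VecP.lookup-replicate i false)))
         (∨-identityʳ _))

Sub-quantifier : ∀ {V} (E D : VarSet V) x → Sub (remove x E) D → Sub E (D ∪ single x)
Sub-quantifier E D x sb i e with i FinP.≟ x
... | yes refl = ∪single-≡ D i
... | no ne = trans (∪single-≢ D x i ne) (sb i (trans (VecP.lookup∘updateAt′ i x ne E) e))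

-- Here a relation symbol always has arity V: an assignment
-- s with domain D corresponds to the total tuple  tupleOf a s  that carries a
-- fixed "padding" element a outside D.
module _ {n : ℕ} where

  asgOf : ∀ {V} → VarSet V → Vec (Fin n) V → Asg n V
  asgOf [] [] = []
  asgOf (b ∷ D) (x ∷ v) = (if b then just x else nothing) ∷ asgOf D v

  tupleOf : ∀ {V} → Fin n → Asg n V → Vec (Fin n) V
  tupleOf a s = Vec.map (fromMaybe a) s

  padded : ∀ {V} → VarSet V → Fin n → Vec (Fin n) V → Bool
  padded [] a [] = true
  padded (true ∷ D) a (x ∷ v) = padded D a v
  padded (false ∷ D) a (x ∷ v) = ⌊ x FinP.≟ a ⌋ ∧ padded D a v

  lookup-asgOf : ∀ {V} (D : VarSet V) v i → lookup (asgOf D v) i ≡ (if lookup D i then just (lookup v i) else nothing)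
  lookup-asgOf (b ∷ D) (x ∷ v) zero = refl
  lookup-asgOf (b ∷ D) (x ∷ v) (suc i) = lookup-asgOf D v i

  padded⇒ : ∀ {V} (D : VarSet V) a v → padded D a v ≡ true → ∀ i → lookup D i ≡ false → lookup v i ≡ a
  padded⇒ (true ∷ D) a (x ∷ v) p (suc i) e = padded⇒ D a v p i e
  padded⇒ (false ∷ D) a (x ∷ v) p i e with x FinP.≟ a | i
  ... | yes x≡a | zero = x≡a
  ... | yes _ | suc i = padded⇒ D a v p i e

  ⇒padded : ∀ {V} (D : VarSet V) a v → (∀ i → lookup D i ≡ false → lookup v i ≡ a) → padded D a v ≡ true
  ⇒padded [] a [] h = refl
  ⇒padded (true ∷ D) a (x ∷ v) h = ⇒padded D a v (λ i → h (suc i))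
  ⇒padded (false ∷ D) a (x ∷ v) h with x FinP.≟ a
  ... | yes _ = ⇒padded D a v (λ i → h (suc i))
  ... | no x≢a = ⊥-elim (x≢a (h zero refl))

  dom-asgOf : ∀ {V} (D : VarSet V) v → Vec.map is-just (asgOf D v) ≡ D
  dom-asgOf [] [] = refl
  dom-asgOf (true ∷ D) (x ∷ v) = cong (true ∷_) (dom-asgOf D v)
  dom-asgOf (false ∷ D) (x ∷ v) = cong (false ∷_) (dom-asgOf D v)

  tupleOf-asgOf : ∀ {V} (D : VarSet V) a v → padded D a v ≡ true → tupleOf a (asgOf D v) ≡ v
  tupleOf-asgOf [] a [] p = refl
  tupleOf-asgOf (true ∷ D) a (x ∷ v) p = cong (x ∷_) (tupleOf-asgOf D a v p)
  tupleOf-asgOf (false ∷ D) a (x ∷ v) p with x FinP.≟ a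
  ... | yes refl = cong (x ∷_) (tupleOf-asgOf D a v p)

  asgOf-tupleOf : ∀ {V} (D : VarSet V) a (s : Asg n V) → Vec.map is-just s ≡ D → asgOf D (tupleOf a s) ≡ s
  asgOf-tupleOf [] a [] e = refl
  asgOf-tupleOf (.true ∷ D) a (just x ∷ s) refl = cong (just x ∷_) (asgOf-tupleOf D a s refl)
  asgOf-tupleOf (.false ∷ D) a (nothing ∷ s) refl = cong (nothing ∷_) (asgOf-tupleOf D a s refl)

  padded-tupleOf : ∀ {V} (D : VarSet V) a (s : Asg n V) → Vec.map is-just s ≡ D → padded D a (tupleOf a s) ≡ true
  padded-tupleOf [] a [] e = refl
  padded-tupleOf (.true ∷ D) a (just x ∷ s) refl = padded-tupleOf D a s refl
  padded-tupleOf (.false ∷ D) a (nothing ∷ s) refl with a FinP.≟ a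
  ... | yes _ = padded-tupleOf D a s refl
  ... | no a≢a = ⊥-elim (a≢a refl)

  fromMaybe-asgOf : ∀ {V} (D : VarSet V) a v i → padded D a v ≡ true → fromMaybe a (lookup (asgOf D v) i) ≡ lookup v i
  fromMaybe-asgOf D a v i p rewrite lookup-asgOf D v i with lookup D i in eD
  ... | true = refl
  ... | false = sym (padded⇒ D a v p i eD)

  allMaybe-complete : ∀ (m : Maybe (Fin n)) → m ∈ allMaybe n
  allMaybe-complete nothing = here refl
  allMaybe-complete (just x) = there (∈-map⁺ just (∈-allFin x))

  allMaybe-unique : Unique (allMaybe n)
  allMaybe-unique = All.tabulate nothing∉ AllPairs.∷ map⁺ just-injective (allFin⁺ n)
    where
    just-injective : ∀ {x y : Fin n} → just x ≡ just y → x ≡ y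
    just-injective refl = refl
    nothing∉ : ∀ {m} → m ∈ L.map just (allFin n) → nothing ≢ m
    nothing∉ m∈ with ∈-map⁻ just m∈
    ... | _ , _ , refl = λ ()

  allAsg≡vecs : ∀ V → allAsg n V ≡ vecs (allMaybe n) V
  allAsg≡vecs zero = refl
  allAsg≡vecs (suc V) = cong (λ xs → L.concatMap (λ m → L.map (m ∷_) xs) (allMaybe n)) (allAsg≡vecs V)

  allAsg-complete : ∀ {V} (s : Asg n V) → s ∈ allAsg n V
  allAsg-complete {V} s = subst (s ∈_) (sym (allAsg≡vecs V)) (vecs-complete (allMaybe n) allMaybe-complete s)

  allAsg-unique : ∀ V → Unique (allAsg n V)
  allAsg-unique V = subst Unique (sym (allAsg≡vecs V)) (vecs-unique (allMaybe n) allMaybe-unique V)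

any⇒ : ∀ {A : Set} (p : A → Bool) xs → any p xs ≡ true → Σ A λ x → x ∈ xs × p x ≡ true
any⇒ p xs e with find (any⁻ p xs (Equivalence.from T-≡ e))
... | x , x∈ , px = x , x∈ , Equivalence.to T-≡ px

⇒any : ∀ {A : Set} (p : A → Bool) {xs x} → x ∈ xs → p x ≡ true → any p xs ≡ true
⇒any p x∈ e = Equivalence.to T-≡ (any⁺ p (lose x∈ (Equivalence.from T-≡ e)))

module _ {n V : ℕ} where

  ==A⇒ : ∀ (s s' : Asg n V) → (s ==A s') ≡ true → s ≡ s'
  ==A⇒ s s' = ⌊⌋⇒ (VecP.≡-dec (MaybeP.≡-dec FinP._≟_) s s')

  ==A-refl : ∀ (s : Asg n V) → (s ==A s) ≡ true
  ==A-refl s = ⇒⌊⌋ (VecP.≡-dec (MaybeP.≡-dec FinP._≟_) s s) refl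

  supp⇒ : ∀ (X : Team n V) F x s' → supp X F x s' ≡ true → Σ (Asg n V) λ s → X s ≡ true × s' ≡ s [ x ↦ F s ]
  supp⇒ X F x s' e with any⇒ (λ s → X s ∧ (s' ==A (s [ x ↦ F s ]))) (allAsg n V) e
  ... | s , _ , q = s , proj₁ (∧-elim q) , ==A⇒ _ _ (proj₂ (∧-elim {X s} q))

  ⇒supp : ∀ (X : Team n V) F x s → X s ≡ true → supp X F x (s [ x ↦ F s ]) ≡ true
  ⇒supp X F x s e = ⇒any (λ s₀ → X s₀ ∧ ((s [ x ↦ F s ]) ==A (s₀ [ x ↦ F s₀ ]))) (allAsg-complete s)
                      (∧-intro e (==A-refl _))

  dupl⇒ : ∀ (X : Team n V) x s' → dupl X x s' ≡ true → Σ (Asg n V) λ s → Σ (Fin n) λ b → X s ≡ true × s' ≡ s [ x ↦ b ]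
  dupl⇒ X x s' e with any⇒ (λ s → X s ∧ any (λ a → s' ==A (s [ x ↦ a ])) (allFin n)) (allAsg n V) e
  ... | s , _ , q with any⇒ (λ a → s' ==A (s [ x ↦ a ])) (allFin n) (proj₂ (∧-elim {X s} q))
  ... | b , _ , r = s , b , proj₁ (∧-elim q) , ==A⇒ _ _ r

  ⇒dupl : ∀ (X : Team n V) x s b → X s ≡ true → dupl X x (s [ x ↦ b ]) ≡ true
  ⇒dupl X x s b e = ⇒any (λ s₀ → X s₀ ∧ any (λ a → (s [ x ↦ b ]) ==A (s₀ [ x ↦ a ])) (allFin n)) (allAsg-complete s)
                      (∧-intro e (⇒any (λ a → (s [ x ↦ b ]) ==A (s [ x ↦ a ])) (∈-allFin b) (==A-refl _)))

  supp-cong : ∀ (X : Team n V) F F' x → (∀ s → X s ≡ true → F s ≡ F' s) → ∀ s' → supp X F x s' ≡ supp X F' x s'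
  supp-cong X F F' x h s' = bool-ext (move F F' h) (move F' F (λ s xs → sym (h s xs)))
    where
    move : ∀ G G' → (∀ s → X s ≡ true → G s ≡ G' s) → supp X G x s' ≡ true → supp X G' x s' ≡ true
    move G G' h e with supp⇒ X G x s' e
    ... | s , xs , refl = subst (λ b → supp X G' x (s [ x ↦ b ]) ≡ true) (sym (h s xs)) (⇒supp X G' x s xs)

  supp-ext : ∀ (X Y : Team n V) F x → (∀ s → X s ≡ Y s) → ∀ s' → supp X F x s' ≡ supp Y F x s'
  supp-ext X Y F x h s' = bool-ext (move X Y h) (move Y X (λ s → sym (h s)))
    where
    move : ∀ X Y → (∀ s → X s ≡ Y s) → supp X F x s' ≡ true → supp Y F x s' ≡ true
    move X Y h e with supp⇒ X F x s' e
    ... | s , xs , refl = ⇒supp Y F x s (trans (sym (h s)) xs)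

  dupl-ext : ∀ (X Y : Team n V) x → (∀ s → X s ≡ Y s) → ∀ s' → dupl X x s' ≡ dupl Y x s'
  dupl-ext X Y x h s' = bool-ext (move X Y h) (move Y X (λ s → sym (h s)))
    where
    move : ∀ X Y → (∀ s → X s ≡ Y s) → dupl X x s' ≡ true → dupl Y x s' ≡ true
    move X Y h e with dupl⇒ X x s' e
    ... | s , b , xs , refl = ⇒dupl Y x s b (trans (sym (h s)) xs)

  tsize-ext : ∀ (X Y : Team n V) → (∀ s → X s ≡ Y s) → tsize X ≡ tsize Y
  tsize-ext X Y h = cong length (LP.filter-≐ (λ s → X s Bool.≟ true) (λ s → Y s Bool.≟ true)
                      ((λ {s} e → trans (sym (h s)) e) , (λ {s} e → trans (h s) e)) (allAsg n V))

  dom-update : ∀ (s : Asg n V) D x b → Vec.map is-just s ≡ D → Vec.map is-just (s [ x ↦ b ]) ≡ D ∪ single x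
  dom-update s D x b refl = vec-ext _ _ at
    where
    at : ∀ i → lookup (Vec.map is-just (s [ x ↦ b ])) i ≡ lookup (Vec.map is-just s ∪ single x) i
    at i with i FinP.≟ x
    ... | yes refl = trans (VecP.lookup-map i is-just (s [ x ↦ b ]))
                       (trans (cong is-just (VecP.lookup∘updateAt i s)) (sym (∪single-≡ (Vec.map is-just s) i)))
    ... | no ne = trans (VecP.lookup-map i is-just (s [ x ↦ b ]))
                    (trans (cong is-just (VecP.lookup∘updateAt′ i x ne s))
                      (trans (sym (VecP.lookup-map i is-just s)) (sym (∪single-≢ (Vec.map is-just s) x i ne))))

  HasDom-supp : ∀ (X : Team n V) D F x → HasDom X D → HasDom (supp X F x) (D ∪ single x)
  HasDom-supp X D F x hd s' e with supp⇒ X F x s' e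
  ... | s , xs , refl = dom-update s D x (F s) (hd s xs)

  HasDom-dupl : ∀ (X : Team n V) D x → HasDom X D → HasDom (dupl X x) (D ∪ single x)
  HasDom-dupl X D x hd s' e with dupl⇒ X x s' e
  ... | s , b , xs , refl = dom-update s D x b (hd s xs)

module Locality {τ : Vocab} (𝔄 : Structure τ) where
  private
    n : ℕ
    n = suc (size 𝔄)

  sat-ext : ∀ {V} (φ : DForm τ V) (X Y : Team n V) → (∀ s → X s ≡ Y s) → sat 𝔄 φ X → sat 𝔄 φ Y
  sat-ext (eq t u) X Y h p s e = p s (trans (h s) e)
  sat-ext (neq t u) X Y h p s e = p s (trans (h s) e)
  sat-ext (rel r ts) X Y h p s e = p s (trans (h s) e)
  sat-ext (nrel r ts) X Y h p s e = p s (trans (h s) e)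
  sat-ext (dep ts t) X Y h p s s' e e' = p s s' (trans (h s) e) (trans (h s') e')
  sat-ext (ndep ts t) X Y h p s = trans (sym (h s)) (p s)
  sat-ext (and φ ψ) X Y h (a , b) = sat-ext φ X Y h a , sat-ext ψ X Y h b
  sat-ext (or φ ψ) X Y h (Y' , Z' , split , a , b) = Y' , Z' , (λ s → trans (sym (h s)) (split s)) , a , b
  sat-ext (ex x φ) X Y h (F , p) = F , sat-ext φ _ _ (supp-ext X Y F x h) p
  sat-ext (all x φ) X Y h p = sat-ext φ _ _ (dupl-ext X Y x h) p
  sat-ext (maj x φ) X Y h (N , half , G , dist , pG) =
    N , subst (λ z → n ^ z ≤ 2 * N) (tsize-ext X Y h) half , G ,
    (λ i j ne → let (s , xs , d) = dist i j ne in s , trans (sym (h s)) xs , d) ,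
    (λ i → sat-ext φ _ _ (supp-ext X Y (G i) x h) (pG i))

  sat-supp-cong : ∀ {V} (φ : DForm τ V) (X : Team n V) F F' x → (∀ s → X s ≡ true → F s ≡ F' s) →
    sat 𝔄 φ (supp X F x) → sat 𝔄 φ (supp X F' x)
  sat-supp-cong φ X F F' x h = sat-ext φ _ _ (supp-cong X F F' x h)

module Syntax (τ : Vocab) (k : ℕ) where

  σ : Vocab
  σ = τ +S k

  ⊤F : ∀ {Γ} → SForm σ Γ
  ⊤F = sall (seq (svar zero) (svar zero))

  _⇒F_ : ∀ {Γ} → SForm σ Γ → SForm σ Γ → SForm σ Γ
  A ⇒F B = sor (sneg A) B

  _⇔F_ : ∀ {Γ} → SForm σ Γ → SForm σ Γ → SForm σ Γ
  A ⇔F B = sand (A ⇒F B) (B ⇒F A)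

  allV : ∀ {a r f} m → SForm σ (ctx (m + a) r f) → SForm σ (ctx a r f)
  allV zero φ = φ
  allV (suc m) φ = allV m (sall φ)

  exV : ∀ {a r f} m → SForm σ (ctx (m + a) r f) → SForm σ (ctx a r f)
  exV zero φ = φ
  exV (suc m) φ = exV m (sex φ)

  ⋀ : ∀ {Γ} m → (Fin m → SForm σ Γ) → SForm σ Γ
  ⋀ zero h = ⊤F
  ⋀ (suc m) h = sand (h zero) (⋀ m (λ i → h (suc i)))

  mutual
    trT : ∀ {V Γ} → (Fin V → STerm σ Γ) → Term τ V → STerm σ Γ
    trT vm (var x) = vm x
    trT vm (app f ts) = sapp f (trTs vm ts)

    trTs : ∀ {V Γ m} → (Fin V → STerm σ Γ) → Vec (Term τ V) m → Vec (STerm σ Γ) m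
    trTs vm [] = []
    trTs vm (t ∷ ts) = trT vm t ∷ trTs vm ts

module Semantics (τ : Vocab) (k : ℕ) (𝔄 : Structure τ) (S : Vec (Fin (suc (size 𝔄))) k → Bool) where
  open Syntax τ k
  open Equivalence using (to; from)

  n : ℕ
  n = suc (size 𝔄)

  𝔅 : Structure σ
  𝔅 = expand 𝔄 S

  B : Set
  B = Fin n

  extV : ∀ {a r f m} → Env n (ctx a r f) → Vec B m → Env n (ctx (m + a) r f)
  extV ρ v = env (v ++ foE ρ) (rE ρ) (fE ρ)

  allV-sem : ∀ {a r f} m (φ : SForm σ (ctx (m + a) r f)) (ρ : Env n (ctx a r f)) →
    ssat 𝔅 (allV m φ) ρ ⇔ (∀ v → ssat 𝔅 φ (extV ρ v))
  allV-sem zero φ ρ = mk⇔ (λ { p [] → p }) (λ p → p [])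
  allV-sem (suc m) φ ρ = mk⇔ (λ { p (b ∷ v) → to (allV-sem m (sall φ) ρ) p v b })
                             (λ p → from (allV-sem m (sall φ) ρ) (λ v b → p (b ∷ v)))

  exV-sem : ∀ {a r f} m (φ : SForm σ (ctx (m + a) r f)) (ρ : Env n (ctx a r f)) →
    ssat 𝔅 (exV m φ) ρ ⇔ (Σ (Vec B m) λ v → ssat 𝔅 φ (extV ρ v))
  exV-sem zero φ ρ = mk⇔ (λ p → [] , p) (λ { ([] , p) → p })
  exV-sem (suc m) φ ρ = mk⇔ (λ p → let (v , b , q) = to (exV-sem m (sex φ) ρ) p in b ∷ v , q)
                            (λ { (b ∷ v , q) → from (exV-sem m (sex φ) ρ) (v , b , q) })

  ⊤F-sem : ∀ {Γ} (ρ : Env n Γ) → ssat 𝔅 ⊤F ρ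
  ⊤F-sem ρ a = refl

  ⋀-sem : ∀ {Γ} m (h : Fin m → SForm σ Γ) ρ → ssat 𝔅 (⋀ m h) ρ ⇔ (∀ i → ssat 𝔅 (h i) ρ)
  ⋀-sem zero h ρ = mk⇔ (λ _ ()) (λ _ → ⊤F-sem ρ)
  ⋀-sem (suc m) h ρ = mk⇔ (λ { (p , q) zero → p ; (p , q) (suc i) → to (⋀-sem m (h ∘ suc) ρ) q i })
                          (λ p → p zero , from (⋀-sem m (h ∘ suc) ρ) (p ∘ suc))

  ⇒F-sem : ∀ {Γ} (ρ : Env n Γ) (A C : SForm σ Γ) {P Q : Set} → Dec P →
    ssat 𝔅 A ρ ⇔ P → ssat 𝔅 C ρ ⇔ Q → ssat 𝔅 (A ⇒F C) ρ ⇔ (P → Q)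
  ⇒F-sem ρ A C (yes p) a c = mk⇔ (λ { (inj₁ ¬a) p → ⊥-elim (¬a (from a p)) ; (inj₂ q) _ → to c q })
                                 (λ h → inj₂ (from c (h p)))
  ⇒F-sem ρ A C (no ¬p) a c = mk⇔ (λ _ p → ⊥-elim (¬p p)) (λ _ → inj₁ (λ q → ¬p (to a q)))

  ⇔F-sem : ∀ {Γ} (ρ : Env n Γ) (A C : SForm σ Γ) {P : Set} (b : Bool) →
    ssat 𝔅 A ρ ⇔ (b ≡ true) → ssat 𝔅 C ρ ⇔ P → ssat 𝔅 (A ⇔F C) ρ ⇔ ((b ≡ true) ⇔ P)
  ⇔F-sem ρ A C b a c = mk⇔
    (λ (p , q) → mk⇔ (to (⇒F-sem ρ A C (b Bool.≟ true) a c) p) (converse q))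
    (λ h → from (⇒F-sem ρ A C (b Bool.≟ true) a c) (to h) , back h)
    where
    converse : ssat 𝔅 (C ⇒F A) ρ → _ → b ≡ true
    converse (inj₁ ¬c) x = ⊥-elim (¬c (from c x))
    converse (inj₂ y) x = to a y
    back : ((b ≡ true) ⇔ _) → ssat 𝔅 (C ⇒F A) ρ
    back h with b Bool.≟ true
    ... | yes e = inj₂ (from a e)
    ... | no ¬e = inj₁ (λ q → ¬e (from h (to c q)))

  sevalTs-tabulate : ∀ {Γ m} (ρ : Env n Γ) (h : Fin m → STerm σ Γ) (v : Vec B m) →
    (∀ i → sevalT 𝔅 ρ (h i) ≡ lookup v i) → sevalTs 𝔅 ρ (tabulate h) ≡ v
  sevalTs-tabulate {m = zero} ρ h [] e = refl
  sevalTs-tabulate {m = suc m} ρ h (b ∷ v) e = cong₂ _∷_ (e zero) (sevalTs-tabulate ρ (λ i → h (suc i)) v (λ i → e (suc i)))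

  lookup-sevalTs : ∀ {Γ m} (ρ : Env n Γ) (us : Vec (STerm σ Γ) m) i → lookup (sevalTs 𝔅 ρ us) i ≡ sevalT 𝔅 ρ (lookup us i)
  lookup-sevalTs ρ (u ∷ us) zero = refl
  lookup-sevalTs ρ (u ∷ us) (suc i) = lookup-sevalTs ρ us i

  mutual
    trT-sem : ∀ {V Γ} (ρ : Env n Γ) (vm : Fin V → STerm σ Γ) (D : VarSet V) (v : Vec B V) →
      (∀ i → sevalT 𝔅 ρ (vm i) ≡ lookup v i) → (t : Term τ V) → Sub (tvars t) D →
      evalT 𝔄 (asgOf D v) t ≡ just (sevalT 𝔅 ρ (trT vm t))
    trT-sem ρ vm D v e (var x) sb rewrite lookup-asgOf D v x | sb x (VecP.lookup∘updateAt x ∅) = cong just (sym (e x))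
    trT-sem ρ vm D v e (app f ts) sb rewrite trTs-sem ρ vm D v e ts sb = refl

    trTs-sem : ∀ {V Γ m} (ρ : Env n Γ) (vm : Fin V → STerm σ Γ) (D : VarSet V) (v : Vec B V) →
      (∀ i → sevalT 𝔅 ρ (vm i) ≡ lookup v i) → (ts : Vec (Term τ V) m) → Sub (tsvars ts) D →
      evalTs 𝔄 (asgOf D v) ts ≡ just (sevalTs 𝔅 ρ (trTs vm ts))
    trTs-sem ρ vm D v e [] sb = refl
    trTs-sem ρ vm D v e (t ∷ ts) sb
      rewrite trT-sem ρ vm D v e t (Sub-∪ˡ (tvars t) (tsvars ts) D sb)
            | trTs-sem ρ vm D v e ts (Sub-∪ʳ (tvars t) (tsvars ts) D sb) = refl

-- A translated formula lives in a context with one first-order variable, the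
-- padding element a, and a V-ary relation variable R₀ standing for the current
-- team (as the relation of its a-padded tuples, see asgOf/tupleOf).
module Translation (τ : Vocab) (k V : ℕ) where
  open Syntax τ k public

  -- a tuple of V variables bound above the padding variable
  cur : ∀ {r f} → Fin V → STerm σ (ctx (V + 1) r f)
  cur i = svar (i ↑ˡ 1)

  pad : ∀ {r f} → STerm σ (ctx (V + 1) r f)
  pad = svar (V ↑ʳ zero)

  -- two such tuples: the outer one (fst) and the inner one (snd)
  fst snd : ∀ {r f} → Fin V → STerm σ (ctx (V + (V + 1)) r f)
  fst i = svar (V ↑ʳ (i ↑ˡ 1))
  snd i = svar (i ↑ˡ (V + 1))

  R₀ : ∀ {a rs f} → (Fin V → STerm σ (ctx a (V ∷ rs) f)) → SForm σ (ctx a (V ∷ rs) f)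
  R₀ vm = rvar zero (tabulate vm)

  R₁ : ∀ {a r rs f} → (Fin V → STerm σ (ctx a (r ∷ V ∷ rs) f)) → SForm σ (ctx a (r ∷ V ∷ rs) f)
  R₁ vm = rvar (suc zero) (tabulate vm)

  R₂ : ∀ {a r r' rs f} → (Fin V → STerm σ (ctx a (r ∷ r' ∷ V ∷ rs) f)) → SForm σ (ctx a (r ∷ r' ∷ V ∷ rs) f)
  R₂ vm = rvar (suc (suc zero)) (tabulate vm)

  eqTs : ∀ {Γ m} → Vec (STerm σ Γ) m → Vec (STerm σ Γ) m → SForm σ Γ
  eqTs {m = m} us ws = ⋀ m (λ i → seq (lookup us i) (lookup ws i))

  agree : ∀ {rs fs} → Fin V → Maybe (STerm σ (ctx (V + (V + 1)) rs fs)) → Fin V → SForm σ (ctx (V + (V + 1)) rs fs)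
  agree x e i with i FinP.≟ x
  agree x e i | no _ = seq (fst i) (snd i)
  agree x nothing i | yes _ = ⊤F
  agree x (just t) i | yes _ = seq (fst i) t

  -- R₀ = { v | ∃ w ∈ R₁. v agrees with w as prescribed by agree x e }:
  -- the team X(A/x) (e = nothing) or X(F/x) (e = just F(w)) of the team R₁.
  defQ : ∀ {rs fs} → Fin V → Maybe (STerm σ (ctx (V + (V + 1)) (V ∷ V ∷ rs) fs)) → SForm σ (ctx 1 (V ∷ V ∷ rs) fs)
  defQ x e = allV V (R₀ cur ⇔F exV V (sand (R₁ snd) (⋀ V (agree x e))))

  defOr : ∀ {rs fs} → SForm σ (ctx 1 (V ∷ V ∷ V ∷ rs) fs)
  defOr = allV V (R₂ cur ⇔F sor (R₁ cur) (R₀ cur))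

  tr : ∀ {rs fs} → VarSet V → DForm τ V → SForm σ (ctx 1 (V ∷ rs) fs)
  -- given the function variable g : Aⱽ → A, the body of ∃x and of Mx
  -- describes the team X(F/x) with F(s) = g(tupleOf a s)
  exBody : ∀ {rs fs} → VarSet V → Fin V → DForm τ V → SForm σ (ctx 1 (V ∷ rs) (V ∷ fs))

  tr D (eq t u) = allV V (R₀ cur ⇒F seq (trT cur t) (trT cur u))
  tr D (neq t u) = allV V (R₀ cur ⇒F sneg (seq (trT cur t) (trT cur u)))
  tr D (rel r ts) = allV V (R₀ cur ⇒F srel (suc r) (trTs cur ts))
  tr D (nrel r ts) = allV V (R₀ cur ⇒F sneg (srel (suc r) (trTs cur ts)))
  tr D (dep ts t) = allV V (allV V (R₀ fst ⇒F (R₀ snd ⇒F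
                      (eqTs (trTs fst ts) (trTs snd ts) ⇒F seq (trT fst t) (trT snd t)))))
  tr D (ndep ts t) = allV V (sneg (R₀ cur))
  tr D (and φ ψ) = sand (tr D φ) (tr D ψ)
  tr D (or φ ψ) = sexR V (sand (tr D φ) (sexR V (sand defOr (tr D ψ))))
  tr D (ex x φ) = sexF V (exBody D x φ)
  tr D (all x φ) = sexR V (sand (defQ x nothing) (tr (D ∪ single x) φ))
  tr D (maj x φ) = most V (exBody D x φ)

  exBody D x φ = sexR V (sand (defQ x (just (fvar zero (tabulate snd)))) (tr (D ∪ single x) φ))

module Correctness (τ : Vocab) (k V : ℕ) (𝔄 : Structure τ) (S : Vec (Fin (suc (size 𝔄))) k → Bool) where
  open Translation τ k V
  open Semantics τ k 𝔄 S public
  open Equivalence using (to; from)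

  cur-ev : ∀ {r f} (ρ : Env n (ctx 1 r f)) v i → sevalT 𝔅 (extV ρ v) (cur i) ≡ lookup v i
  cur-ev ρ v i = VecP.lookup-++ˡ v (foE ρ) i

  pad-ev : ∀ {r f} (ρ : Env n (ctx 1 r f)) v → sevalT 𝔅 (extV ρ v) pad ≡ lookup (foE ρ) zero
  pad-ev ρ v = VecP.lookup-++ʳ v (foE ρ) zero

  ρ₂ : ∀ {r f} → Env n (ctx 1 r f) → Vec B V → Vec B V → Env n (ctx (V + (V + 1)) r f)
  ρ₂ ρ v w = extV {m = V} (extV {m = V} ρ v) w

  fst-ev : ∀ {r f} (ρ : Env n (ctx 1 r f)) v w i → sevalT 𝔅 (ρ₂ ρ v w) (fst i) ≡ lookup v i
  fst-ev ρ v w i = trans (VecP.lookup-++ʳ w (v ++ foE ρ) (i ↑ˡ 1)) (VecP.lookup-++ˡ v (foE ρ) i)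

  snd-ev : ∀ {r f} (ρ : Env n (ctx 1 r f)) v w i → sevalT 𝔅 (ρ₂ ρ v w) (snd i) ≡ lookup w i
  snd-ev ρ v w i = VecP.lookup-++ˡ w (v ++ foE ρ) i

  R₀-sem : ∀ {a rs f} (ρ : Env n (ctx a (V ∷ rs) f)) vm v → (∀ i → sevalT 𝔅 ρ (vm i) ≡ lookup v i) →
    ssat 𝔅 (R₀ vm) ρ ⇔ (rE ρ zero v ≡ true)
  R₀-sem ρ vm v e rewrite sevalTs-tabulate ρ vm v e = mk⇔ (λ z → z) (λ z → z)

  R₁-sem : ∀ {a r rs f} (ρ : Env n (ctx a (r ∷ V ∷ rs) f)) vm v → (∀ i → sevalT 𝔅 ρ (vm i) ≡ lookup v i) →
    ssat 𝔅 (R₁ vm) ρ ⇔ (rE ρ (suc zero) v ≡ true)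
  R₁-sem ρ vm v e rewrite sevalTs-tabulate ρ vm v e = mk⇔ (λ z → z) (λ z → z)

  R₂-sem : ∀ {a r r' rs f} (ρ : Env n (ctx a (r ∷ r' ∷ V ∷ rs) f)) vm v → (∀ i → sevalT 𝔅 ρ (vm i) ≡ lookup v i) →
    ssat 𝔅 (R₂ vm) ρ ⇔ (rE ρ (suc (suc zero)) v ≡ true)
  R₂-sem ρ vm v e rewrite sevalTs-tabulate ρ vm v e = mk⇔ (λ z → z) (λ z → z)

  eqTs-sem : ∀ {Γ m} (ρ : Env n Γ) (us ws : Vec (STerm σ Γ) m) → ssat 𝔅 (eqTs us ws) ρ ⇔ (sevalTs 𝔅 ρ us ≡ sevalTs 𝔅 ρ ws)
  eqTs-sem {m = m} ρ us ws = mk⇔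
    (λ p → vec-ext _ _ λ i → trans (lookup-sevalTs ρ us i) (trans (to (⋀-sem m _ ρ) p i) (sym (lookup-sevalTs ρ ws i))))
    (λ e → from (⋀-sem m _ ρ) λ i → trans (sym (lookup-sevalTs ρ us i)) (trans (cong (λ z → lookup z i) e) (lookup-sevalTs ρ ws i)))

  relOf : VarSet V → B → Team n V → Vec B V → Bool
  relOf D a X v = padded D a v ∧ X (asgOf D v)

  Represents : VarSet V → B → Team n V → (Vec B V → Bool) → Set
  Represents D a X R = HasDom X D × (∀ v → R v ≡ relOf D a X v)

  module _ {D : VarSet V} {a : B} {X : Team n V} {R : Vec B V → Bool} (rp : Represents D a X R) where

    represents-member : ∀ s → X s ≡ true → asgOf D (tupleOf a s) ≡ s × R (tupleOf a s) ≡ true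
    represents-member s xs = back , trans (proj₂ rp (tupleOf a s))
                               (∧-intro (padded-tupleOf D a s (proj₁ rp s xs)) (trans (cong X back) xs))
      where back = asgOf-tupleOf D a s (proj₁ rp s xs)

    represents-team : ∀ v → R v ≡ true → X (asgOf D v) ≡ true
    represents-team v e = proj₂ (∧-elim {padded D a v} (trans (sym (proj₂ rp v)) e))

    represents-padded : ∀ v → R v ≡ true → padded D a v ≡ true
    represents-padded v e = proj₁ (∧-elim {padded D a v} (trans (sym (proj₂ rp v)) e))

  hasDomain : VarSet V → Asg n V → Bool
  hasDomain D s = ⌊ VecP.≡-dec Bool._≟_ (Vec.map is-just s) D ⌋

  teamOf : VarSet V → B → (Vec B V → Bool) → Team n V
  teamOf D a R s = hasDomain D s ∧ R (tupleOf a s)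

  represents-teamOf : ∀ D a R → (∀ v → R v ≡ true → padded D a v ≡ true) → Represents D a (teamOf D a R) R
  represents-teamOf D a R only-padded = dom , λ v → bool-ext (forth v) (back v)
    where
    dom : HasDom (teamOf D a R) D
    dom s e = ⌊⌋⇒ (VecP.≡-dec Bool._≟_ _ D) (proj₁ (∧-elim e))
    forth : ∀ v → R v ≡ true → (padded D a v ∧ teamOf D a R (asgOf D v)) ≡ true
    forth v e = ∧-intro (only-padded v e) (∧-intro (⇒⌊⌋ (VecP.≡-dec Bool._≟_ _ D) (dom-asgOf D v))
                  (trans (cong R (tupleOf-asgOf D a v (only-padded v e))) e))
    back : ∀ v → (padded D a v ∧ teamOf D a R (asgOf D v)) ≡ true → R v ≡ true
    back v e with ∧-elim {padded D a v} e
    ... | p , t = trans (cong R (sym (tupleOf-asgOf D a v p))) (proj₂ (∧-elim {hasDomain D (asgOf D v)} t))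

  represented-team : ∀ {D a X R} → Represents D a X R → ∀ s → X s ≡ teamOf D a R s
  represented-team {D} {a} {X} {R} rp s = bool-ext forth back
    where
    forth : X s ≡ true → teamOf D a R s ≡ true
    forth e = ∧-intro (⇒⌊⌋ (VecP.≡-dec Bool._≟_ _ D) (proj₁ rp s e)) (proj₂ (represents-member rp s e))
    back : teamOf D a R s ≡ true → X s ≡ true
    back e with ∧-elim {hasDomain D s} e
    ... | d , r = trans (cong X (sym (asgOf-tupleOf D a s (⌊⌋⇒ (VecP.≡-dec Bool._≟_ _ D) d)))) (represents-team rp _ r)

  AtX : ∀ {rs fs} → Fin V → Maybe (STerm σ (ctx (V + (V + 1)) rs fs)) → Env n (ctx (V + (V + 1)) rs fs) → Vec B V → Set
  AtX x nothing ρ' v = ⊤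
  AtX x (just t) ρ' v = lookup v x ≡ sevalT 𝔅 ρ' t

  module _ {rs fs : List ℕ} (ρ : Env n (ctx 1 rs fs)) (x : Fin V) where

    agree-off : ∀ e v w i → i ≢ x → ssat 𝔅 (agree x e i) (ρ₂ ρ v w) ⇔ (lookup v i ≡ lookup w i)
    agree-off e v w i ne with i FinP.≟ x
    ... | yes i≡x = ⊥-elim (ne i≡x)
    ... | no _ = mk⇔ (λ q → trans (sym (fst-ev ρ v w i)) (trans q (snd-ev ρ v w i)))
                     (λ q → trans (fst-ev ρ v w i) (trans q (sym (snd-ev ρ v w i))))

    agree-at : ∀ e v w → ssat 𝔅 (agree x e x) (ρ₂ ρ v w) ⇔ AtX x e (ρ₂ ρ v w) v
    agree-at e v w with x FinP.≟ x
    agree-at e v w | no x≢x = ⊥-elim (x≢x refl)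
    agree-at nothing v w | yes _ = mk⇔ _ (λ _ → ⊤F-sem (ρ₂ ρ v w))
    agree-at (just t) v w | yes _ = mk⇔ (trans (sym (fst-ev ρ v w x))) (trans (fst-ev ρ v w x))

    agree-sem : ∀ e v w → ssat 𝔅 (⋀ V (agree x e)) (ρ₂ ρ v w) ⇔
                  ((∀ i → i ≢ x → lookup v i ≡ lookup w i) × AtX x e (ρ₂ ρ v w) v)
    agree-sem e v w = mk⇔
      (λ p → (λ i ne → to (agree-off e v w i ne) (to (⋀-sem V _ _) p i)) , to (agree-at e v w) (to (⋀-sem V _ _) p x))
      (λ (off , at) → from (⋀-sem V _ _) λ i → at-i i off at)
      where
      at-i : ∀ i → (∀ i → i ≢ x → lookup v i ≡ lookup w i) → AtX x e (ρ₂ ρ v w) v → ssat 𝔅 (agree x e i) (ρ₂ ρ v w)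
      at-i i off at = by-cases (i FinP.≟ x)
        where
        by-cases : Dec (i ≡ x) → ssat 𝔅 (agree x e i) (ρ₂ ρ v w)
        by-cases (yes i≡x) = subst (λ j → ssat 𝔅 (agree x e j) (ρ₂ ρ v w)) (sym i≡x) (from (agree-at e v w) at)
        by-cases (no ne) = from (agree-off e v w i ne) (off i ne)

  Step : ∀ {rs fs} (ρ : Env n (ctx 1 (V ∷ V ∷ rs) fs)) (x : Fin V) →
    Maybe (STerm σ (ctx (V + (V + 1)) (V ∷ V ∷ rs) fs)) → Vec B V → Set
  Step ρ x e v = Σ (Vec B V) λ w → rE ρ (suc zero) w ≡ true ×
    ((∀ i → i ≢ x → lookup v i ≡ lookup w i) × AtX x e (ρ₂ ρ v w) v)

  defQ-sem : ∀ {rs fs} (ρ : Env n (ctx 1 (V ∷ V ∷ rs) fs)) x e →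
    ssat 𝔅 (defQ x e) ρ ⇔ (∀ v → (rE ρ zero v ≡ true) ⇔ Step ρ x e v)
  defQ-sem ρ x e = mk⇔ (λ p v → to (pointwise v) (to (allV-sem V _ ρ) p v))
                       (λ h → from (allV-sem V _ ρ) λ v → from (pointwise v) (h v))
    where
    body : ∀ v → ssat 𝔅 (exV V (sand (R₁ snd) (⋀ V (agree x e)))) (extV ρ v) ⇔ Step ρ x e v
    body v = mk⇔
      (λ p → let (w , r , a) = to (exV-sem V (sand (R₁ snd) (⋀ V (agree x e))) (extV ρ v)) p
             in w , to (R₁-sem (ρ₂ ρ v w) snd w (snd-ev ρ v w)) r , to (agree-sem ρ x e v w) a)
      (λ (w , r , a) → from (exV-sem V (sand (R₁ snd) (⋀ V (agree x e))) (extV ρ v))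
             (w , from (R₁-sem (ρ₂ ρ v w) snd w (snd-ev ρ v w)) r , from (agree-sem ρ x e v w) a))
    pointwise : ∀ v → _
    pointwise v = ⇔F-sem (extV ρ v) (R₀ cur) (exV V (sand (R₁ snd) (⋀ V (agree x e)))) (rE ρ zero v) (R₀-sem (extV ρ v) cur v (cur-ev ρ v)) (body v)

  defOr-sem : ∀ {rs fs} (ρ : Env n (ctx 1 (V ∷ V ∷ V ∷ rs) fs)) →
    ssat 𝔅 defOr ρ ⇔ (∀ v → rE ρ (suc (suc zero)) v ≡ (rE ρ (suc zero) v ∨ rE ρ zero v))
  defOr-sem ρ = mk⇔ (λ p v → bool-ext′ (to (pointwise v) (to (allV-sem V _ ρ) p v)))
                    (λ h → from (allV-sem V _ ρ) λ v → from (pointwise v) (mk⇔ (λ e → trans (sym (h v)) e) (λ e → trans (h v) e)))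
    where
    bool-ext′ : ∀ {b c} → (b ≡ true) ⇔ (c ≡ true) → b ≡ c
    bool-ext′ h = bool-ext (to h) (from h)
    union : ∀ v → ssat 𝔅 (sor (R₁ cur) (R₀ cur)) (extV ρ v) ⇔ ((rE ρ (suc zero) v ∨ rE ρ zero v) ≡ true)
    union v = mk⇔ (λ { (inj₁ p) → ∨-introˡ (to (R₁-sem (extV ρ v) cur v (cur-ev ρ v)) p)
                     ; (inj₂ q) → ∨-introʳ _ (to (R₀-sem (extV ρ v) cur v (cur-ev ρ v)) q) })
                  (λ e → Sum.map (from (R₁-sem (extV ρ v) cur v (cur-ev ρ v)))
                                      (from (R₀-sem (extV ρ v) cur v (cur-ev ρ v))) (∨-elim e))
    pointwise : ∀ v → _
    pointwise v = ⇔F-sem (extV ρ v) (R₂ cur) (sor (R₁ cur) (R₀ cur)) (rE ρ (suc (suc zero)) v) (R₂-sem (extV ρ v) cur v (cur-ev ρ v)) (union v)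

  module Step {D : VarSet V} {a : B} {X : Team n V} {R : Vec B V → Bool} (rp : Represents D a X R) (x : Fin V) where
    D' : VarSet V
    D' = D ∪ single x

    step→ : ∀ v w → R w ≡ true → (∀ i → i ≢ x → lookup v i ≡ lookup w i) →
      padded D' a v ≡ true × X (asgOf D w) ≡ true × asgOf D' v ≡ asgOf D w [ x ↦ lookup v x ]
    step→ v w r off = ⇒padded D' a v padding , represents-team rp w r , vec-ext _ _ at
      where
      padding : ∀ i → lookup D' i ≡ false → lookup v i ≡ a
      padding i e with i FinP.≟ x
      ... | yes refl = ⊥-elim (false≢true (trans (sym e) (∪single-≡ D x)))
      ... | no ne = trans (off i ne) (padded⇒ D a w (represents-padded rp w r) i (trans (sym (∪single-≢ D x i ne)) e))
      at : ∀ i → lookup (asgOf D' v) i ≡ lookup (asgOf D w [ x ↦ lookup v x ]) i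
      at i with i FinP.≟ x
      ... | yes refl rewrite lookup-asgOf D' v i | ∪single-≡ D i = sym (VecP.lookup∘updateAt i (asgOf D w))
      ... | no ne rewrite lookup-asgOf D' v i | ∪single-≢ D x i ne
                        | VecP.lookup∘updateAt′ i x {f = λ _ → just (lookup v x)} ne (asgOf D w)
                        | lookup-asgOf D w i | off i ne = refl

    step← : ∀ v s b → X s ≡ true → asgOf D' v ≡ s [ x ↦ b ] → padded D' a v ≡ true →
      R (tupleOf a s) ≡ true × (∀ i → i ≢ x → lookup v i ≡ lookup (tupleOf a s) i) × lookup v x ≡ b
    step← v s b xs e p = proj₂ (represents-member rp s xs) , off , at-x
      where
      off : ∀ i → i ≢ x → lookup v i ≡ lookup (tupleOf a s) i
      off i ne = begin
        lookup v i                                 ≡⟨ sym (fromMaybe-asgOf D' a v i p) ⟩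
        fromMaybe a (lookup (asgOf D' v) i)        ≡⟨ cong (λ z → fromMaybe a (lookup z i)) e ⟩
        fromMaybe a (lookup (s [ x ↦ b ]) i)       ≡⟨ cong (fromMaybe a) (VecP.lookup∘updateAt′ i x ne s) ⟩
        fromMaybe a (lookup s i)                   ≡⟨ sym (VecP.lookup-map i (fromMaybe a) s) ⟩
        lookup (tupleOf a s) i                     ∎
        where open ≡-Reasoning
      just-injective : ∀ {y z : B} → just y ≡ just z → y ≡ z
      just-injective refl = refl
      at-x : lookup v x ≡ b
      at-x = just-injective (begin
        just (lookup v x)                                                  ≡⟨ cong (λ c → if c then just (lookup v x) else nothing) (sym (∪single-≡ D x)) ⟩
        (if lookup D' x then just (lookup v x) else nothing)               ≡⟨ sym (lookup-asgOf D' v x) ⟩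
        lookup (asgOf D' v) x                                              ≡⟨ cong (λ z → lookup z x) e ⟩
        lookup (s [ x ↦ b ]) x                                             ≡⟨ VecP.lookup∘updateAt x s ⟩
        just b                                                             ∎)
        where open ≡-Reasoning

    supp-rel : ∀ (G : Vec B V → B) v →
      (Σ (Vec B V) λ w → R w ≡ true × ((∀ i → i ≢ x → lookup v i ≡ lookup w i) × lookup v x ≡ G w)) ⇔
      (relOf D' a (supp X (λ s → G (tupleOf a s)) x) v ≡ true)
    supp-rel G v = mk⇔ forth back
      where
      F : Asg n V → B
      F s = G (tupleOf a s)
      forth : _ → _
      forth (w , r , off , at-x) with step→ v w r off
      ... | p , xs , e = ∧-intro p (subst (λ z → supp X F x z ≡ true) (sym (trans e (cong (asgOf D w [ x ↦_]) at-x′)))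
                                          (⇒supp X F x (asgOf D w) xs))
        where
        at-x′ : lookup v x ≡ F (asgOf D w)
        at-x′ = trans at-x (cong G (sym (tupleOf-asgOf D a w (represents-padded rp w r))))
      back : _ → _
      back e with ∧-elim {padded D' a v} e
      ... | p , sp with supp⇒ X F x _ sp
      ... | s , xs , e' = tupleOf a s , step← v s (F s) xs e' p

    dupl-rel : ∀ v →
      (Σ (Vec B V) λ w → R w ≡ true × ((∀ i → i ≢ x → lookup v i ≡ lookup w i) × ⊤)) ⇔
      (relOf D' a (dupl X x) v ≡ true)
    dupl-rel v = mk⇔ forth back
      where
      forth : _ → _
      forth (w , r , off , _) with step→ v w r off
      ... | p , xs , e = ∧-intro p (subst (λ z → dupl X x z ≡ true) (sym e) (⇒dupl X x (asgOf D w) (lookup v x) xs))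
      back : _ → _
      back e with ∧-elim {padded D' a v} e
      ... | p , dp with dupl⇒ X x _ dp
      ... | s , b , xs , e' with step← v s b xs e' p
      ... | r , off , _ = tupleOf a s , r , off , _

module TranslationCorrect (τ : Vocab) (k V : ℕ) (𝔄 : Structure τ) (S : Vec (Fin (suc (size 𝔄))) k → Bool) where
  open Translation τ k V
  open Correctness τ k V 𝔄 S
  open Equivalence using (to; from)

  padOf : ∀ {r f} → Env n (ctx 1 r f) → B
  padOf ρ = lookup (foE ρ) zero

  Correct : DForm τ V → Set
  Correct φ = ∀ {rs fs} (D : VarSet V) → Sub (Fr φ) D → (ρ : Env n (ctx 1 (V ∷ rs) fs)) (X : Team n V) →
    Represents D (padOf ρ) X (rE ρ zero) → sat 𝔄 φ X ⇔ ssat 𝔅 (tr D φ) ρ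

  flat-sem : ∀ {rs fs} (D : VarSet V) (ρ : Env n (ctx 1 (V ∷ rs) fs)) X (L : Asg n V → Set)
    (body : SForm σ (ctx (V + 1) (V ∷ rs) fs)) → Represents D (padOf ρ) X (rE ρ zero) →
    (∀ v → L (asgOf D v) ⇔ ssat 𝔅 body (extV ρ v)) →
    (∀ s → X s ≡ true → L s) ⇔ ssat 𝔅 (allV V (R₀ cur ⇒F body)) ρ
  flat-sem D ρ X L body rp link = mk⇔
    (λ h → from (allV-sem V _ ρ) λ v → from (pointwise v) λ r → to (link v) (h _ (represents-team rp v r)))
    (λ p s xs → let (back , r) = represents-member rp s xs in
                subst L back (from (link _) (to (pointwise _) (to (allV-sem V _ ρ) p _) r)))
    where
    pointwise : ∀ v → _
    pointwise v = ⇒F-sem (extV ρ v) (R₀ cur) body (rE ρ zero v Bool.≟ true) (R₀-sem (extV ρ v) cur v (cur-ev ρ v)) (mk⇔ (λ z → z) (λ z → z))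

  evaluates : ∀ {rs fs} D (ρ : Env n (ctx 1 (V ∷ rs) fs)) v (t : Term τ V) → Sub (tvars t) D →
    evalT 𝔄 (asgOf D v) t ≡ just (sevalT 𝔅 (extV ρ v) (trT cur t))
  evaluates D ρ v = trT-sem (extV ρ v) cur D v (cur-ev ρ v)

  holdsEq-sem : ∀ (s : Asg n V) t u b α β → evalT 𝔄 s t ≡ just α → evalT 𝔄 s u ≡ just β →
    holdsEq 𝔄 s t u b ⇔ (⌊ α FinP.≟ β ⌋ ≡ b)
  holdsEq-sem s t u b α β et eu rewrite et | eu = mk⇔ (λ z → z) (λ z → z)

  holdsRel-sem : ∀ (s : Asg n V) r ts b as → evalTs 𝔄 s ts ≡ just as →
    holdsRel 𝔄 s r ts b ⇔ (relI 𝔄 r as ≡ b)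
  holdsRel-sem s r ts b as e rewrite e = mk⇔ (λ z → z) (λ z → z)

  ⌊⌋-true : ∀ (α β : B) → (⌊ α FinP.≟ β ⌋ ≡ true) ⇔ (α ≡ β)
  ⌊⌋-true α β = mk⇔ (⌊⌋⇒ (α FinP.≟ β)) (⇒⌊⌋ (α FinP.≟ β))

  ⌊⌋-false : ∀ (α β : B) → (⌊ α FinP.≟ β ⌋ ≡ false) ⇔ (¬ α ≡ β)
  ⌊⌋-false α β with α FinP.≟ β
  ... | yes p = mk⇔ (λ ()) (λ ¬p → ⊥-elim (¬p p))
  ... | no ¬p = mk⇔ (λ _ → ¬p) (λ _ → refl)

  false⇔¬true : ∀ (b : Bool) → (b ≡ false) ⇔ (¬ b ≡ true)
  false⇔¬true true = mk⇔ (λ ()) (λ z → ⊥-elim (z refl))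
  false⇔¬true false = mk⇔ (λ _ ()) (λ _ → refl)

  correct-eq : ∀ t u → Correct (eq t u)
  correct-eq t u D sb ρ X rp = flat-sem D ρ X (λ s → holdsEq 𝔄 s t u true) _ rp λ v →
    ⇔-trans (holdsEq-sem (asgOf D v) t u true _ _ (evaluates D ρ v t (Sub-∪ˡ (tvars t) (tvars u) D sb))
                                                  (evaluates D ρ v u (Sub-∪ʳ (tvars t) (tvars u) D sb)))
            (⌊⌋-true _ _)

  correct-neq : ∀ t u → Correct (neq t u)
  correct-neq t u D sb ρ X rp = flat-sem D ρ X (λ s → holdsEq 𝔄 s t u false) _ rp λ v →
    ⇔-trans (holdsEq-sem (asgOf D v) t u false _ _ (evaluates D ρ v t (Sub-∪ˡ (tvars t) (tvars u) D sb))
                                                   (evaluates D ρ v u (Sub-∪ʳ (tvars t) (tvars u) D sb)))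
            (⌊⌋-false _ _)

  correct-rel : ∀ r ts → Correct (rel r ts)
  correct-rel r ts D sb ρ X rp = flat-sem D ρ X (λ s → holdsRel 𝔄 s r ts true) _ rp λ v →
    holdsRel-sem (asgOf D v) r ts true _ (trTs-sem (extV ρ v) cur D v (cur-ev ρ v) ts sb)

  correct-nrel : ∀ r ts → Correct (nrel r ts)
  correct-nrel r ts D sb ρ X rp = flat-sem D ρ X (λ s → holdsRel 𝔄 s r ts false) _ rp λ v →
    ⇔-trans (holdsRel-sem (asgOf D v) r ts false _ (trTs-sem (extV ρ v) cur D v (cur-ev ρ v) ts sb)) (false⇔¬true _)

  correct-dep : ∀ {m} (ts : Vec (Term τ V) m) t → Correct (dep ts t)
  correct-dep ts t D sb ρ X rp = mk⇔ forth back
    where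
    a = padOf ρ
    R = rE ρ zero
    sbts = Sub-∪ˡ (tsvars ts) (tvars t) D sb
    sbt = Sub-∪ʳ (tsvars ts) (tvars t) D sb
    tsᵛ tsʷ : Vec B V → Vec B V → Vec B _
    tsᵛ v w = sevalTs 𝔅 (ρ₂ ρ v w) (trTs fst ts)
    tsʷ v w = sevalTs 𝔅 (ρ₂ ρ v w) (trTs snd ts)
    tᵛ tʷ : Vec B V → Vec B V → B
    tᵛ v w = sevalT 𝔅 (ρ₂ ρ v w) (trT fst t)
    tʷ v w = sevalT 𝔅 (ρ₂ ρ v w) (trT snd t)
    ev-tsᵛ : ∀ v w → evalTs 𝔄 (asgOf D v) ts ≡ just (tsᵛ v w)
    ev-tsᵛ v w = trTs-sem (ρ₂ ρ v w) fst D v (fst-ev ρ v w) ts sbts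
    ev-tsʷ : ∀ v w → evalTs 𝔄 (asgOf D w) ts ≡ just (tsʷ v w)
    ev-tsʷ v w = trTs-sem (ρ₂ ρ v w) snd D w (snd-ev ρ v w) ts sbts
    ev-tᵛ : ∀ v w → evalT 𝔄 (asgOf D v) t ≡ just (tᵛ v w)
    ev-tᵛ v w = trT-sem (ρ₂ ρ v w) fst D v (fst-ev ρ v w) t sbt
    ev-tʷ : ∀ v w → evalT 𝔄 (asgOf D w) t ≡ just (tʷ v w)
    ev-tʷ v w = trT-sem (ρ₂ ρ v w) snd D w (snd-ev ρ v w) t sbt
    just-injective : ∀ {A : Set} {x y : A} → _≡_ {A = Maybe A} (just x) (just y) → x ≡ y
    just-injective refl = refl
    pointwise : ∀ v w → ssat 𝔅 (R₀ fst ⇒F (R₀ snd ⇒F (eqTs (trTs fst ts) (trTs snd ts) ⇒F seq (trT fst t) (trT snd t)))) (ρ₂ ρ v w) ⇔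
                (R v ≡ true → R w ≡ true → tsᵛ v w ≡ tsʷ v w → tᵛ v w ≡ tʷ v w)
    pointwise v w =
      ⇒F-sem (ρ₂ ρ v w) (R₀ fst) (R₀ snd ⇒F same⇒same) (R v Bool.≟ true) (R₀-sem (ρ₂ ρ v w) fst v (fst-ev ρ v w))
        (⇒F-sem (ρ₂ ρ v w) (R₀ snd) same⇒same (R w Bool.≟ true) (R₀-sem (ρ₂ ρ v w) snd w (snd-ev ρ v w))
          (⇒F-sem (ρ₂ ρ v w) (eqTs (trTs fst ts) (trTs snd ts)) (seq (trT fst t) (trT snd t))
                  (VecP.≡-dec FinP._≟_ _ _) (eqTs-sem (ρ₂ ρ v w) _ _) (mk⇔ (λ z → z) (λ z → z))))
      where same⇒same = eqTs (trTs fst ts) (trTs snd ts) ⇒F seq (trT fst t) (trT snd t)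
    forth : sat 𝔄 (dep ts t) X → ssat 𝔅 (tr D (dep ts t)) ρ
    forth h = from (allV-sem V _ ρ) λ v → from (allV-sem V _ (extV ρ v)) λ w → from (pointwise v w) λ r r' same →
      just-injective (trans (sym (ev-tᵛ v w))
        (trans (h _ _ (represents-team rp v r) (represents-team rp w r')
                 (trans (ev-tsᵛ v w) (trans (cong just same) (sym (ev-tsʷ v w)))))
               (ev-tʷ v w)))
    back : ssat 𝔅 (tr D (dep ts t)) ρ → sat 𝔄 (dep ts t) X
    back p s s' xs xs' same with represents-member rp s xs | represents-member rp s' xs'
    ... | e , r | e' , r' = subst₂ (λ z z' → evalT 𝔄 z t ≡ evalT 𝔄 z' t) e e'
          (trans (ev-tᵛ v w) (trans (cong just (to (pointwise v w) pvw r r' same-ts)) (sym (ev-tʷ v w))))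
      where
      v = tupleOf a s
      w = tupleOf a s'
      pvw = to (allV-sem V _ (extV ρ v)) (to (allV-sem V _ ρ) p v) w
      same-ts : tsᵛ v w ≡ tsʷ v w
      same-ts = just-injective (trans (sym (ev-tsᵛ v w))
                  (trans (subst₂ (λ z z' → evalTs 𝔄 z ts ≡ evalTs 𝔄 z' ts) (sym e) (sym e') same) (ev-tsʷ v w)))

  correct-ndep : ∀ {m} (ts : Vec (Term τ V) m) t → Correct (ndep ts t)
  correct-ndep ts t D sb ρ X rp = mk⇔
    (λ h → from (allV-sem V _ ρ) λ v r →
       false≢true (trans (sym (h _)) (represents-team rp v (to (R₀-sem (extV ρ v) cur v (cur-ev ρ v)) r))))
    (λ p s → empty p s (X s) refl)
    where
    empty : ssat 𝔅 (tr D (ndep ts t)) ρ → ∀ s b → X s ≡ b → X s ≡ false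
    empty p s false e = e
    empty p s true e = ⊥-elim (to (allV-sem V _ ρ) p v (from (R₀-sem (extV ρ v) cur v (cur-ev ρ v)) (proj₂ (represents-member rp s e))))
      where v = tupleOf (padOf ρ) s

  correct-and : ∀ φ ψ → Correct φ → Correct ψ → Correct (and φ ψ)
  correct-and φ ψ IHφ IHψ D sb ρ X rp =
    IHφ D (Sub-∪ˡ (Fr φ) (Fr ψ) D sb) ρ X rp ×-⇔ IHψ D (Sub-∪ʳ (Fr φ) (Fr ψ) D sb) ρ X rp

  correct-or : ∀ φ ψ → Correct φ → Correct ψ → Correct (or φ ψ)
  correct-or φ ψ IHφ IHψ D sb ρ X rp = mk⇔ forth back
    where
    a = padOf ρ
    R = rE ρ zero
    sφ = Sub-∪ˡ (Fr φ) (Fr ψ) D sb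
    sψ = Sub-∪ʳ (Fr φ) (Fr ψ) D sb
    forth : sat 𝔄 (or φ ψ) X → ssat 𝔅 (tr D (or φ ψ)) ρ
    forth (Y , Z , split , pY , pZ) =
      relOf D a Y , to (IHφ D sφ (extR ρ (relOf D a Y)) Y (domY , λ v → refl)) pY ,
      relOf D a Z , from (defOr-sem (extR (extR ρ (relOf D a Y)) (relOf D a Z))) union ,
      to (IHψ D sψ (extR (extR ρ (relOf D a Y)) (relOf D a Z)) Z (domZ , λ v → refl)) pZ
      where
      domY : HasDom Y D
      domY s e = proj₁ rp s (trans (split s) (∨-introˡ e))
      domZ : HasDom Z D
      domZ s e = proj₁ rp s (trans (split s) (∨-introʳ (Y s) e))
      union : ∀ v → R v ≡ (relOf D a Y v ∨ relOf D a Z v)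
      union v = trans (proj₂ rp v) (trans (cong (padded D a v ∧_) (split (asgOf D v))) (∧-distribˡ-∨ (padded D a v) _ _))
    back : ssat 𝔅 (tr D (or φ ψ)) ρ → sat 𝔄 (or φ ψ) X
    back (RY , pY , RZ , dO , pZ) = teamOf D a RY , teamOf D a RZ , split ,
      from (IHφ D sφ (extR ρ RY) _ (represents-teamOf D a RY paddedY)) pY ,
      from (IHψ D sψ (extR (extR ρ RY) RZ) _ (represents-teamOf D a RZ paddedZ)) pZ
      where
      union = to (defOr-sem (extR (extR ρ RY) RZ)) dO
      paddedY : ∀ v → RY v ≡ true → padded D a v ≡ true
      paddedY v e = represents-padded rp v (trans (union v) (∨-introˡ e))
      paddedZ : ∀ v → RZ v ≡ true → padded D a v ≡ true
      paddedZ v e = represents-padded rp v (trans (union v) (∨-introʳ (RY v) e))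
      split : ∀ s → X s ≡ (teamOf D a RY s ∨ teamOf D a RZ s)
      split s = trans (represented-team rp s)
                  (trans (cong (hasDomain D s ∧_) (union (tupleOf a s))) (∧-distribˡ-∨ (hasDomain D s) _ _))

  step-sem : ∀ {rs fs} φ → Correct φ → (D' : VarSet V) → Sub (Fr φ) D' → (ρ : Env n (ctx 1 (V ∷ rs) fs)) → ∀ x e →
    (X' : Team n V) → HasDom X' D' → (∀ R' v → Step (extR ρ R') x e v ⇔ (relOf D' (padOf ρ) X' v ≡ true)) →
    sat 𝔄 φ X' ⇔ ssat 𝔅 (sexR V (sand (defQ x e) (tr D' φ))) ρ
  step-sem φ IH D' sb ρ x e X' dom step = mk⇔ forth back
    where
    forth : sat 𝔄 φ X' → _
    forth p = R' , from (defQ-sem (extR ρ R') x e) (λ v → mk⇔ (from (step R' v)) (to (step R' v))) ,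
              to (IH D' sb (extR ρ R') X' (dom , λ v → refl)) p
      where R' = relOf D' (padOf ρ) X'
    back : _ → sat 𝔄 φ X'
    back (R' , dq , p) = from (IH D' sb (extR ρ R') X' (dom , same)) p
      where
      same : ∀ v → R' v ≡ relOf D' (padOf ρ) X' v
      same v = bool-ext (λ r → to (step R' v) (to (to (defQ-sem (extR ρ R') x e) dq v) r))
                        (λ r → from (to (defQ-sem (extR ρ R') x e) dq v) (from (step R' v) r))

  correct-all : ∀ x φ → Correct φ → Correct (all x φ)
  correct-all x φ IH D sb ρ X rp =
    step-sem φ IH (D ∪ single x) (Sub-quantifier (Fr φ) D x sb) ρ x nothing (dupl X x) (HasDom-dupl X D x (proj₁ rp))
      (λ R' v → Step.dupl-rel rp x v)

  exBody-sem : ∀ {rs fs} x φ → Correct φ → (D : VarSet V) → Sub (Fr (ex x φ)) D →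
    (ρ : Env n (ctx 1 (V ∷ rs) fs)) (X : Team n V) → Represents D (padOf ρ) X (rE ρ zero) → ∀ g →
    sat 𝔄 φ (supp X (λ s → g (tupleOf (padOf ρ) s)) x) ⇔ ssat 𝔅 (exBody D x φ) (extF ρ g)
  exBody-sem x φ IH D sb ρ X rp g =
    step-sem φ IH (D ∪ single x) (Sub-quantifier (Fr φ) D x sb) (extF ρ g) x (just g⟨snd⟩) _
      (HasDom-supp X D _ x (proj₁ rp)) (λ R' v → ⇔-trans (value-at-x R' v) (Step.supp-rel rp x g v))
    where
    g⟨snd⟩ = fvar zero (tabulate snd)
    value-at-x : ∀ R' v → Step (extR (extF ρ g) R') x (just g⟨snd⟩) v ⇔
      (Σ (Vec B V) λ w → rE ρ zero w ≡ true × ((∀ i → i ≢ x → lookup v i ≡ lookup w i) × lookup v x ≡ g w))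
    value-at-x R' v = mk⇔ (λ (w , r , off , at) → w , r , off , trans at (g-w w))
                          (λ (w , r , off , at) → w , r , off , trans at (sym (g-w w)))
      where
      g-w : ∀ w → sevalT 𝔅 (ρ₂ (extR (extF ρ g) R') v w) g⟨snd⟩ ≡ g w
      g-w w = cong g (sevalTs-tabulate (ρ₂ (extR (extF ρ g) R') v w) snd w (snd-ev (extR (extF ρ g) R') v w))

  correct-ex : ∀ x φ → Correct φ → Correct (ex x φ)
  correct-ex x φ IH D sb ρ X rp = mk⇔
    (λ (F , p) → (λ w → F (asgOf D w)) , to (exBody-sem x φ IH D sb ρ X rp _)
                   (sat-supp-cong φ X F _ x (λ s xs → cong F (sym (proj₁ (represents-member rp s xs)))) p))
    (λ (g , q) → (λ s → g (tupleOf (padOf ρ) s)) , from (exBody-sem x φ IH D sb ρ X rp g) q)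
    where open Locality 𝔄

  -- Counting a represented team: its members correspond to the tuples of its relation.
  tuples : List (Vec B V)
  tuples = vecs (allFin n) V

  tuples-complete : ∀ v → v ∈ tuples
  tuples-complete = vecs-complete (allFin n) ∈-allFin

  tuples-unique : Unique tuples
  tuples-unique = vecs-unique (allFin n) (allFin⁺ n) V

  tsize-represented : ∀ {D a X R} → Represents D a X R → tsize X ≡ length (select R true tuples)
  tsize-represented {D} {a} {X} {R} rp = ≤-antisym
    (length-≤ members inRel (select-unique X true (allAsg-unique V)) (tupleOf a)
      (λ s m → ∈-select⁺ R (tuples-complete _) (proj₂ (represents-member rp s (member m))))
      (λ s s' m m' e → trans (sym (proj₁ (represents-member rp s (member m))))
                         (trans (cong (asgOf D) e) (proj₁ (represents-member rp s' (member m'))))))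
    (length-≤ inRel members (select-unique R true tuples-unique) (asgOf D)
      (λ v m → ∈-select⁺ X (allAsg-complete _) (represents-team rp v (related m)))
      (λ v v' m m' e → trans (sym (tupleOf-asgOf D a v (represents-padded rp v (related m))))
                         (trans (cong (tupleOf a) e) (tupleOf-asgOf D a v' (represents-padded rp v' (related m'))))))
    where
    members = select X true (allAsg n V)
    inRel = select R true tuples
    member : ∀ {s} → s ∈ members → X s ≡ true
    member m = proj₂ (∈-select⁻ X (allAsg n V) m)
    related : ∀ {v} → v ∈ inRel → R v ≡ true
    related m = proj₂ (∈-select⁻ R tuples m)

  threshold-cong : ∀ {P Q : ℕ → Set} {e e' : ℕ} → e ≡ e' → (∀ N → P N ⇔ Q N) →
    (Σ ℕ λ N → n ^ e ≤ 2 * N × P N) ⇔ (Σ ℕ λ N → n ^ e' ≤ 2 * N × Q N)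
  threshold-cong refl PQ = mk⇔ (λ (N , half , p) → N , half , to (PQ N) p) (λ (N , half , q) → N , half , from (PQ N) q)

  -- The majority quantifier: counting functions X → A satisfying φ in X(F/x) is
  -- counting functions Aⱽ → A satisfying the body, by LocalCounting with Lc the
  -- tuples of R₀ (which correspond to X) and Ld the remaining tuples.
  correct-maj : ∀ x φ → Correct φ → Correct (maj x φ)
  correct-maj x φ IH D sb ρ X rp =
    ⇔-trans (threshold-cong team-size small)
      (⇔-trans majority-transfer (threshold-cong all-tuples big))
    where
    open Locality 𝔄
    a = padOf ρ
    R = rE ρ zero
    Lc = select R true tuples
    Ld = select R false tuples
    disjoint : ∀ t → t ∈ Lc → t ∈ Ld → ⊥
    disjoint t p q = false≢true (trans (sym (proj₂ (∈-select⁻ R tuples q))) (proj₂ (∈-select⁻ R tuples p)))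
    cover : ∀ t → t ∈ Lc ⊎ t ∈ Ld
    cover t with R t in e
    ... | true = inj₁ (∈-select⁺ R (tuples-complete t) e)
    ... | false = inj₂ (∈-select⁺ R (tuples-complete t) e)
    P : (Vec B V → B) → Set
    P g = sat 𝔄 φ (supp X (λ s → g (tupleOf a s)) x)
    member∈Lc : ∀ s → X s ≡ true → tupleOf a s ∈ Lc
    member∈Lc s xs = ∈-select⁺ R (tuples-complete _) (proj₂ (represents-member rp s xs))
    local : ∀ f g → (∀ t → t ∈ Lc → f t ≡ g t) → P f → P g
    local f g agree = sat-supp-cong φ X _ _ x (λ s xs → agree (tupleOf a s) (member∈Lc s xs))
    open LocalCounting (size 𝔄) (Vec B V) Lc Ld (select-unique R true tuples-unique) (select-unique R false tuples-unique) disjoint cover P local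
      hiding (n)
    team-size : tsize X ≡ c
    team-size = tsize-represented rp
    all-tuples : c + d ≡ n ^ V
    all-tuples = trans (length-split R tuples)
                   (trans (vecs-length (allFin n) V) (cong (_^ V) (LP.length-tabulate {n = n} (λ i → i))))
    small : ∀ N → AtLeastOn X N (λ F → sat 𝔄 φ (supp X F x)) ⇔ DistinctOnLc N
    small N = mk⇔
      (λ (F , dist , pF) → (λ i t → F i (asgOf D t)) ,
        (λ i j ne → let (s , xs , differ) = dist i j ne
                    in tupleOf a s , member∈Lc s xs ,
                       subst (λ z → F i z ≢ F j z) (sym (proj₁ (represents-member rp s xs))) differ) ,
        (λ i → sat-supp-cong φ X (F i) _ x (λ s xs → cong (F i) (sym (proj₁ (represents-member rp s xs)))) (pF i)))
      (λ (G , dist , pG) → (λ i s → G i (tupleOf a s)) ,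
        (λ i j ne → let (t , t∈ , differ) = dist i j ne
                        r = proj₂ (∈-select⁻ R tuples t∈)
                    in asgOf D t , represents-team rp t r ,
                       subst (λ z → G i z ≢ G j z) (sym (tupleOf-asgOf D a t (represents-padded rp t r))) differ) ,
        pG)
    big : ∀ M → Distinct M ⇔ AtLeastFun 𝔅 V M (λ g → ssat 𝔅 (exBody D x φ) (extF ρ g))
    big M = mk⇔ (λ (G , dist , pG) → G , dist , λ i → to (exBody-sem x φ IH D sb ρ X rp (G i)) (pG i))
                (λ (G , dist , pG) → G , dist , λ i → from (exBody-sem x φ IH D sb ρ X rp (G i)) (pG i))

  correct : ∀ φ → Correct φ
  correct (eq t u) = correct-eq t u
  correct (neq t u) = correct-neq t u
  correct (rel r ts) = correct-rel r ts
  correct (nrel r ts) = correct-nrel r ts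
  correct (dep ts t) = correct-dep ts t
  correct (ndep ts t) = correct-ndep ts t
  correct (and φ ψ) = correct-and φ ψ (correct φ) (correct ψ)
  correct (or φ ψ) = correct-or φ ψ (correct φ) (correct ψ)
  correct (ex x φ) = correct-ex x φ (correct φ)
  correct (all x φ) = correct-all x φ (correct φ)
  correct (maj x φ) = correct-maj x φ (correct φ)

elems-member : ∀ {V} (D : VarSet V) j → lookup D (lookup (elems D) j) ≡ true
elems-member (true ∷ D) zero = refl
elems-member (true ∷ D) (suc j) rewrite VecP.lookup-map j Fin.suc (elems D) = elems-member D j
elems-member (false ∷ D) j rewrite VecP.lookup-map j Fin.suc (elems D) = elems-member D j

elems-complete : ∀ {V} (D : VarSet V) i → lookup D i ≡ true → Σ (Fin (card D)) λ j → lookup (elems D) j ≡ i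
elems-complete (true ∷ D) zero e = zero , refl
elems-complete (true ∷ D) (suc i) e with elems-complete D i e
... | j , p = suc j , trans (VecP.lookup-map j Fin.suc (elems D)) (cong suc p)
elems-complete (false ∷ D) (suc i) e with elems-complete D i e
... | j , p = j , trans (VecP.lookup-map j Fin.suc (elems D)) (cong suc p)

relT-padded : ∀ {n V} (D : VarSet V) (X : Team n V) (a : Fin n) v → HasDom X D → padded D a v ≡ true →
  relT D X (Vec.map (lookup v) (elems D)) ≡ X (asgOf D v)
relT-padded {n} {V} D X a v dom p = bool-ext forth back
  where
  ≟A = VecP.≡-dec (MaybeP.≡-dec FinP._≟_)
  t = Vec.map (lookup v) (elems D)
  lookup-t : ∀ j → lookup (Vec.map just t) j ≡ just (lookup v (lookup (elems D) j))
  lookup-t j = trans (VecP.lookup-map j just t) (cong just (VecP.lookup-map j (lookup v) (elems D)))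
  forth : relT D X t ≡ true → X (asgOf D v) ≡ true
  forth e with any⇒ (λ s → X s ∧ ⌊ ≟A (Vec.map (lookup s) (elems D)) (Vec.map just t) ⌋) (allAsg n V) e
  ... | s , _ , q with ∧-elim {X s} q
  ... | xs , same = subst (λ z → X z ≡ true) (vec-ext s (asgOf D v) at) xs
    where
    on-D : Vec.map (lookup s) (elems D) ≡ Vec.map just t
    on-D = ⌊⌋⇒ (≟A _ _) same
    at : ∀ i → lookup s i ≡ lookup (asgOf D v) i
    at i rewrite lookup-asgOf D v i with lookup D i in eD
    ... | true with elems-complete D i eD
    ...   | j , refl = trans (sym (VecP.lookup-map j (lookup s) (elems D))) (trans (cong (λ z → lookup z j) on-D) (lookup-t j))
    at i | false with lookup s i in es
    ...   | nothing = refl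
    ...   | just _ = ⊥-elim (false≢true (trans (sym eD)
                       (trans (cong (λ z → lookup z i) (sym (dom s xs))) (trans (VecP.lookup-map i is-just s) (cong is-just es)))))
  back : X (asgOf D v) ≡ true → relT D X t ≡ true
  back e = ⇒any (λ s → X s ∧ ⌊ ≟A (Vec.map (lookup s) (elems D)) (Vec.map just t) ⌋) (allAsg-complete (asgOf D v))
             (∧-intro e (⇒⌊⌋ (≟A _ _) (vec-ext _ _ at)))
    where
    at : ∀ j → lookup (Vec.map (lookup (asgOf D v)) (elems D)) j ≡ lookup (Vec.map just t) j
    at j rewrite VecP.lookup-map j (lookup (asgOf D v)) (elems D) | lookup-asgOf D v (lookup (elems D) j)
               | elems-member D j = sym (lookup-t j)

-- The sentence ψ for φ:  ∀a ∃R (R = {v | v padded by a outside Fr(φ), S(v↾Fr(φ))} ∧ tr φ).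
-- The first conjunct makes R the relation of the team with rel(X) = S.
module TheSentence (τ : Vocab) (V : ℕ) (φ : DForm τ V) where
  D : VarSet V
  D = Fr φ
  open Translation τ (card D) V

  paddedF : SForm σ (ctx (V + 1) (V ∷ []) [])
  paddedF = ⋀ V (λ i → if lookup D i then ⊤F else seq (cur i) pad)

  initial : SForm σ (ctx 1 (V ∷ []) [])
  initial = allV V (R₀ cur ⇔F sand paddedF (srel zero (Vec.map cur (elems D))))

  ψ : Sentence σ
  ψ = sall (sexR V (sand initial (tr D φ)))

  module _ (𝔄 : Structure τ) (X : Team (suc (size 𝔄)) V) (dom : HasDom X D) where
    open Correctness τ (card D) V 𝔄 (relT D X)
    open TranslationCorrect τ (card D) V 𝔄 (relT D X) using (correct)
    open Equivalence using (to; from)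

    ρ₀ : B → (Vec B V → Bool) → Env n (ctx 1 (V ∷ []) [])
    ρ₀ a R = extR (extFO emptyEnv a) R

    paddedF-sem : ∀ a R v → ssat 𝔅 paddedF (extV (ρ₀ a R) v) ⇔ (padded D a v ≡ true)
    paddedF-sem a R v = mk⇔ (λ p → ⇒padded D a v λ i e → outside i e (to (⋀-sem V _ _) p i))
                            (λ p → from (⋀-sem V _ _) λ i → inside i p)
      where
      ρ' = extV (ρ₀ a R) v
      outside : ∀ i → lookup D i ≡ false → ssat 𝔅 (if lookup D i then ⊤F else seq (cur i) pad) ρ' → lookup v i ≡ a
      outside i e q rewrite e = trans (sym (cur-ev (ρ₀ a R) v i)) (trans q (pad-ev (ρ₀ a R) v))
      inside : ∀ i → padded D a v ≡ true → ssat 𝔅 (if lookup D i then ⊤F else seq (cur i) pad) ρ'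
      inside i p with lookup D i in e
      ... | true = ⊤F-sem ρ'
      ... | false = trans (cur-ev (ρ₀ a R) v i) (trans (padded⇒ D a v p i e) (sym (pad-ev (ρ₀ a R) v)))

    S-sem : ∀ a R v → sevalTs 𝔅 (extV (ρ₀ a R) v) (Vec.map cur (elems D)) ≡ Vec.map (lookup v) (elems D)
    S-sem a R v = vec-ext _ _ λ j → begin
      lookup (sevalTs 𝔅 (extV (ρ₀ a R) v) (Vec.map cur (elems D))) j   ≡⟨ lookup-sevalTs (extV (ρ₀ a R) v) (Vec.map cur (elems D)) j ⟩
      sevalT 𝔅 (extV (ρ₀ a R) v) (lookup (Vec.map cur (elems D)) j)   ≡⟨ cong (sevalT 𝔅 _) (VecP.lookup-map j cur (elems D)) ⟩
      sevalT 𝔅 (extV (ρ₀ a R) v) (cur (lookup (elems D) j))           ≡⟨ cur-ev (ρ₀ a R) v _ ⟩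
      lookup v (lookup (elems D) j)                                   ≡⟨ sym (VecP.lookup-map j (lookup v) (elems D)) ⟩
      lookup (Vec.map (lookup v) (elems D)) j                         ∎
      where open ≡-Reasoning

    relOf-sem : ∀ a R v → ssat 𝔅 (sand paddedF (srel zero (Vec.map cur (elems D)))) (extV (ρ₀ a R) v) ⇔
                  (relOf D a X v ≡ true)
    relOf-sem a R v = mk⇔
      (λ (p , s) → let p′ = to (paddedF-sem a R v) p in
         ∧-intro p′ (trans (sym (relT-padded D X a v dom p′)) (trans (cong (relT D X) (sym (S-sem a R v))) s)))
      (λ e → let (p , x) = ∧-elim {padded D a v} e in
         from (paddedF-sem a R v) p , trans (cong (relT D X) (S-sem a R v)) (trans (relT-padded D X a v dom p) x))

    initial-sem : ∀ a R → ssat 𝔅 initial (ρ₀ a R) ⇔ (∀ v → R v ≡ relOf D a X v)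
    initial-sem a R = mk⇔
      (λ p v → let h = to (pointwise v) (to (allV-sem V _ (ρ₀ a R)) p v) in bool-ext (to h) (from h))
      (λ h → from (allV-sem V _ (ρ₀ a R)) λ v → from (pointwise v) (mk⇔ (λ e → trans (sym (h v)) e) (λ e → trans (h v) e)))
      where
      pointwise : ∀ v → _
      pointwise v = ⇔F-sem (extV (ρ₀ a R) v) (R₀ cur) (sand paddedF (srel zero (Vec.map cur (elems D)))) (R v)
                      (R₀-sem (extV (ρ₀ a R) v) cur v (cur-ev (ρ₀ a R) v)) (relOf-sem a R v)

    ψ-correct : sat 𝔄 φ X ⇔ (expand 𝔄 (relT D X) ⊨ ψ)
    ψ-correct = mk⇔
      (λ p a → relOf D a X , from (initial-sem a _) (λ v → refl) ,
                 to (correct φ D (λ i e → e) (ρ₀ a (relOf D a X)) X (dom , λ v → refl)) p)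
      (λ p → let (R , init , q) = p zero in
               from (correct φ D (λ i e → e) (ρ₀ zero R) X (dom , to (initial-sem zero R) init)) q)

lemma4p1 : (τ : Vocab) (V : ℕ) (φ : DForm τ V) →
    Σ (Sentence (τ +S card (Fr φ))) λ ψ →
    (𝔄 : Structure τ) (X : Team (suc (size 𝔄)) V) → HasDom X (Fr φ) →
    (sat 𝔄 φ X ⇔ (expand 𝔄 (relT (Fr φ) X) ⊨ ψ))
lemma4p1 τ V φ = ψ , ψ-correct
  where open TheSentence τ V φ
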